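{- Let $G=(V,E)$ be a graph satisfying the standing assumptions, with derived graph $\bar G=(\bar V,\bar E)$ as defined below, and let $u,v\in V$ with $\tau(u)=\tau(v)=3$. Then (1) $\min_u=\min_v$ if and only if $\min_{\bar u}=\min_{\bar v}$; (2) $\min_u\prec\min_v$ if and only if $\min_{\bar u}\prec'\min_{\bar v}$.
   Context: Standing assumptions: $\Sigma$ is a finite alphabet with a total order $\preceq$; $G=(V,E)$ is finite, $E\subseteq V\times V\times\Sigma$, every character labels some edge, every node has an incoming edge, all edges entering a node $u$ have the same label $\lambda(u)$ (edges are written $(u,v)$), and $G$ is deterministic (for each $u$ and $a$ at most one $v$ with $(u,v)\in E$, $\lambda(v)=a$). Strings in $\Sigma^\omega$ are ordered lexicographically; $\alpha[i]$ is the $i$-th character, $\alpha[i,j]=\alpha[i]\cdots\alpha[j]$. An occurrence of $\alpha\in\Sigma^\omega$ starting at $u$ is a sequence $(u_i)_{i\ge1}$ with $u_1=u$, $(u_{i+1},u_i)\in E$, $\lambda(u_i)=\alpha[i]$. $\min_u$ is the lexicographically smallest string having an occurrence starting at $u$. For $\alpha=a\alpha'$ ($a\in\Sigma$): $\tau(\alpha)=1$ if $\alpha'\prec\alpha$, $2$ if $\alpha'=\alpha$, $3$ if $\alpha\prec\alpha'$; $\tau(u):=\tau(\min_u)$. For $\tau(u)=3$, $\ell_u$ is the smallest $k\ge2$ with $\tau(u_k)\ge2$ for an (any) occurrence $(u_i)$ of $\min_u$ starting at $u$. For nonempty $R\subseteq V$, $R'=\arg\min_{v\in R}\lambda(v)$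 and $\mathtt{F}(R)=\arg\min_{v\in R'}\tau(v)$. $G_1(u)=\{u\}$, and for $1<i\le\ell_u$, $G_i(u)=\mathtt{F}(\{v': \exists v\in G_{i-1}(u),(v',v)\in E\})\setminus\bigcup_{j=2}^{i-1}G_j(u)$. $\gamma_u=\min_u[1,\ell_u]$, $\mathtt{t}_u=\tau(G_{\ell_u}(u))\in\{2,3\}$ (common $\tau$-value of nodes in $G_{\ell_u}(u)$). $\Sigma'=\{(\gamma_u,\mathtt{t}_u):\tau(u)=3\}$, with $(\alpha,x)\prec'(\beta,y)$ for distinct pairs iff $\alpha$ is not a prefix of $\beta$ and $\alpha\prec\beta$, or $\alpha=\beta,x=2,y=3$, or $\beta$ is a strict prefix of $\alpha$. $\bar G$: nodes $\bar u$ for $\tau(u)=3$, labels $\lambda(\bar u)=(\gamma_u,\mathtt{t}_u)$, edges $\{(\bar v,\bar v):\mathtt{t}_v=2\}\cup\{(\bar u,\bar v):\mathtt{t}_v=3,u\in G_{\ell_v}(v)\}$; minima in $\bar G$ use the lexicographic extension of $\preceq'$. -}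

module Defs where

open import Data.Nat as ℕ using (ℕ; zero; suc; _∸_; _≤ᵇ_; _≤_)
open import Data.Fin as Fin using (Fin; toℕ)
open import Data.Bool using (Bool; true; false; _∧_; _∨_; not)
open import Data.List using (List; []; _∷_; _++_; map; upTo; filterᵇ; allFin)
open import Data.Bool.ListAction using (all; any)
open import Data.Fin.Properties using (_≟_)
open import Relation.Nullary.Decidable using (⌊_⌋)
open import Data.Product using (Σ; ∃; ∃₂; _×_; _,_; proj₁)
open import Data.Sum using (_⊎_)
open import Data.Empty using (⊥)
open import Data.Unit using (⊤)
open import Relation.Binary.PropositionalEquality using (_≡_)

-- An edge (u,v) carries the label lab v of its target, so E ⊆ V × V × Σ
-- is represented by the adjacency relation E u v ≡ true.

record Graph : Set where
  field
    n m            : ℕ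
    lab            : Fin n → Fin m
    E              : Fin n → Fin n → Bool
    everyCharLabels : ∀ (a : Fin m) → ∃₂ λ u v → E u v ≡ true × lab v ≡ a
    hasIncoming    : ∀ v → ∃ λ u → E u v ≡ true
    deterministic  : ∀ u v w → E u v ≡ true → E u w ≡ true → lab v ≡ lab w → v ≡ w

-- Infinite strings (indexed from 0: α i is the paper's α[i+1]) and
-- the lexicographic order induced by a strict order on the alphabet.

module Lex {A : Set} (_<ᴬ_ : A → A → Set) where

  Str : Set
  Str = ℕ → A

  _≈ω_ : Str → Str → Set
  α ≈ω β = ∀ i → α i ≡ β i

  _≺ω_ : Str → Str → Set
  α ≺ω β = ∃ λ i → (∀ j → j ℕ.< i → α j ≡ β j) × (α i <ᴬ β i)

  _⪯ω_ : Str → Str → Set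
  α ⪯ω β = (α ≺ω β) ⊎ (α ≈ω β)

  tail : Str → Str
  tail α i = α (suc i)

module Paths {N A : Set} (Edge : N → N → Set) (lab : N → A) (_<ᴬ_ : A → A → Set) where

  open Lex _<ᴬ_ public

  Occurrence : N → Str → Set
  Occurrence u α = Σ (ℕ → N) λ us →
    (us 0 ≡ u) × (∀ i → Edge (us (suc i)) (us i)) × (∀ i → lab (us i) ≡ α i)

  IsMin : N → Str → Set
  IsMin u α = Occurrence u α × (∀ β → Occurrence u β → α ⪯ω β)

module GraphOps (G : Graph) where
  open Graph G
  open Paths (λ u v → E u v ≡ true) lab Fin._<_ public

  Tau : Str → ℕ → Set
  Tau α 1 = tail α ≺ω α
  Tau α 2 = tail α ≈ω α
  Tau α 3 = α ≺ω tail α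
  Tau α _ = ⊥

-- The (uniquely determined) functions u ↦ min_u, u ↦ τ(u), u ↦ ℓ_u,
-- given together with their defining specifications.
record MinData (G : Graph) : Set where
  open Graph G
  open GraphOps G
  field
    mn       : Fin n → Str
    mn-isMin : ∀ u → IsMin u (mn u)
    τ        : Fin n → ℕ
    τ-spec   : ∀ u → Tau (mn u) (τ u)
    ℓ        : Fin n → ℕ
    -- ℓ_u is the smallest k ≥ 2 with τ(u_k) ≥ 2 for an occurrence (u_i)
    -- of min_u starting at u (u_k is us (k ∸ 1) in 0-based indexing)
    ℓ-spec   : ∀ u → τ u ≡ 3 →
      (2 ≤ ℓ u) × Σ (Occurrence u (mn u)) λ occ →
        (2 ≤ τ (proj₁ occ (ℓ u ∸ 1))) ×
        (∀ j → 2 ≤ j → j ℕ.< ℓ u → τ (proj₁ occ (j ∸ 1)) ℕ.< 2)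

module FinStr {A : Set} (_<ᴬ_ : A → A → Set) where

  _≺fin_ : List A → List A → Set
  []       ≺fin []       = ⊥
  []       ≺fin (_ ∷ _)  = ⊤
  (_ ∷ _)  ≺fin []       = ⊥
  (a ∷ as) ≺fin (b ∷ bs) = (a <ᴬ b) ⊎ ((a ≡ b) × (as ≺fin bs))

  IsPrefix : List A → List A → Set
  IsPrefix α β = ∃ λ δ → α ++ δ ≡ β

  IsStrictPrefix : List A → List A → Set
  IsStrictPrefix α β = ∃₂ λ c δ → α ++ (c ∷ δ) ≡ β

module Derived (G : Graph) (D : MinData G) where
  open Graph G
  open GraphOps G public
  open MinData D public

  Subset : Set
  Subset = Fin n → Bool

  allV : (Fin n → Bool) → Bool
  allV p = all p (allFin n)

  anyV : (Fin n → Bool) → Bool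
  anyV p = any p (allFin n)

  _≤Σᵇ_ : Fin m → Fin m → Bool
  a ≤Σᵇ b = toℕ a ≤ᵇ toℕ b

  argminLab : Subset → Subset
  argminLab R v = R v ∧ allV (λ w → not (R w) ∨ (lab v ≤Σᵇ lab w))

  F : Subset → Subset
  F R v = argminLab R v ∧ allV (λ w → not (argminLab R w) ∨ (τ v ≤ᵇ τ w))

  preds : Subset → Subset
  preds S v' = anyV (λ v → S v ∧ E v' v)

  single : Fin n → Subset
  single u w = ⌊ u ≟ w ⌋

  _∪ₛ_ _∖ₛ_ : Subset → Subset → Subset
  (S ∪ₛ T) w = S w ∨ T w
  (S ∖ₛ T) w = S w ∧ not (T w)

  emptyₛ : Subset
  emptyₛ _ = false

  -- Gseq u k = (G_{k+1}(u) , G_2(u) ∪ … ∪ G_{k+1}(u))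
  Gseq : Fin n → ℕ → Subset × Subset
  Gseq u zero = single u , emptyₛ
  Gseq u (suc k) with Gseq u k
  ... | (Gk , Uk) = let Gk+1 = F (preds Gk) ∖ₛ Uk in Gk+1 , (Uk ∪ₛ Gk+1)

  Gi : Fin n → ℕ → Subset
  Gi u i = proj₁ (Gseq u (i ∸ 1))

  γ : Fin n → List (Fin m)
  γ u = map (mn u) (upTo (ℓ u))

  -- t_u = τ(G_{ℓ_u}(u)), the common τ-value of the nodes of G_{ℓ_u}(u)
  -- (taken at the first node of G_{ℓ_u}(u); this set is nonempty)
  τOfFirst : List (Fin n) → ℕ
  τOfFirst []      = 3
  τOfFirst (w ∷ _) = τ w

  t : Fin n → ℕ
  t u = τOfFirst (filterᵇ (Gi u (ℓ u)) (allFin n))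

  Label' : Set
  Label' = List (Fin m) × ℕ

  open FinStr (λ (a b : Fin m) → a Fin.< b)

  _≺'_ : Label' → Label' → Set
  (α , x) ≺' (β , y) =
      ((¬' IsPrefix α β) × (α ≺fin β))
    ⊎ ((α ≡ β) × (x ≡ 2) × (y ≡ 3))
    ⊎ IsStrictPrefix β α
    where ¬'_ : Set → Set
          ¬' P = P → ⊥

  V̄ : Set
  V̄ = Σ (Fin n) λ u → τ u ≡ 3

  λ̄ : V̄ → Label'
  λ̄ (u , _) = γ u , t u

  Ē : V̄ → V̄ → Set
  Ē (u , _) (v , _) = ((t v ≡ 2) × (u ≡ v)) ⊎ ((t v ≡ 3) × (Gi v (ℓ v) u ≡ true))

  module Bar = Paths Ē λ̄ _≺'_

-- Expand a string over Σ' by replacing each letter (γ_w , t_w) with γ_w minus its last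
-- letter, followed by that last letter forever when t_w = 2. The greedy sets G_i(u)
-- follow min_u: G_{ℓ_u}(u) is reached from u by reading γ_u minus its last letter and
-- contains a node at which min_u continues. Hence the expansion of a Ḡ-occurrence from x̄
-- is a limit of occurrences from x and never below min_x, while following those
-- continuation nodes gives a Ḡ-occurrence from ū that expands exactly to min_u; so min_ū
-- expands to min_u. Finally ≺' is designed so that expansion is strictly monotone on
-- Ḡ-occurrences, which transfers both equality and order between min_ū, min_v̄ and
-- min_u, min_v.
module Submission where

open import Defs
open import Data.Nat as ℕ using (ℕ; zero; suc; _+_; _∸_; _⊓_; _≤_; _<_; z≤n; s≤s)
import Data.Nat.Properties as ℕP
open import Data.Fin as Fin using (Fin; toℕ)
open import Data.Bool using (Bool; true; false; T; not; _∧_; _∨_)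
import Data.Fin.Properties as FinP
open import Data.Product using (Σ; ∃; _×_; _,_; proj₁; proj₂)
open import Data.Sum using (_⊎_; inj₁; inj₂)
open import Data.Empty using (⊥-elim)
open import Relation.Nullary using (¬_; Dec; yes; no; ¬?; _×-dec_)
open import Relation.Binary.Definitions using (tri<; tri≈; tri>)
open import Relation.Binary.Structures using (IsStrictTotalOrder)
open import Relation.Binary.PropositionalEquality
open import Function using (_∘_)
open import Function.Bundles using (_⇔_; mk⇔; Equivalence)
open import Function.Properties.Equivalence using () renaming (trans to ⇔-trans)
open import Data.Bool.Properties using (T-∧; T-∨; T-≡)
open import Data.List using (List; []; _∷_; length; applyUpTo; upTo; allFin; filterᵇ)
open import Data.List.Relation.Unary.Any using (here; there)
open import Data.List.Properties using (∷-injectiveˡ; ∷-injectiveʳ; ++-identityʳ; length-map; length-upTo; map-upTo)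
import Data.List.Relation.Unary.All as All
import Data.List.Relation.Unary.Any as Any
open import Data.List.Relation.Unary.All.Properties using (all⁺; all⁻)
open import Data.List.Relation.Unary.Any.Properties using (any⁺; any⁻)
open import Data.List.Membership.Propositional using (_∈_; lose)
open import Data.List.Membership.Propositional.Properties using (∈-allFin)
open import Relation.Nullary.Decidable using (toWitness; fromWitness)

module LexProperties {A : Set} (_<ᴬ_ : A → A → Set) where
  open Lex _<ᴬ_

  AgreeBelow : ℕ → Str → Str → Set
  AgreeBelow K α β = ∀ k → k ℕ.< K → α k ≡ β k

  shift : ℕ → Str → Str
  shift k α i = α (k + i)

  ≈ω-refl : ∀ {α} → α ≈ω α
  ≈ω-refl _ = refl

  ≈ω-sym : ∀ {α β} → α ≈ω β → β ≈ω α
  ≈ω-sym e i = sym (e i)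

  ≈ω-trans : ∀ {α β γ} → α ≈ω β → β ≈ω γ → α ≈ω γ
  ≈ω-trans e f i = trans (e i) (f i)

  ≺ω-resp-≈ω : ∀ {α α' β β'} → α ≈ω α' → β ≈ω β' → α ≺ω β → α' ≺ω β'
  ≺ω-resp-≈ω eα eβ (i , agree , lt) =
    i , (λ j j<i → trans (sym (eα j)) (trans (agree j j<i) (eβ j))) ,
    subst₂ _<ᴬ_ (eα i) (eβ i) lt

  ≈ω-cong-⇔ : ∀ {α α' β β'} → α ≈ω α' → β ≈ω β' → (α ≈ω β) ⇔ (α' ≈ω β')
  ≈ω-cong-⇔ eα eβ = mk⇔ (λ e → ≈ω-trans (≈ω-sym eα) (≈ω-trans e eβ))
                        (λ e → ≈ω-trans eα (≈ω-trans e (≈ω-sym eβ)))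

  ≺ω-cong-⇔ : ∀ {α α' β β'} → α ≈ω α' → β ≈ω β' → (α ≺ω β) ⇔ (α' ≺ω β')
  ≺ω-cong-⇔ eα eβ = mk⇔ (≺ω-resp-≈ω eα eβ) (≺ω-resp-≈ω (≈ω-sym eα) (≈ω-sym eβ))

  AgreeBelow-suc : ∀ {K α β} → AgreeBelow K α β → α K ≡ β K → AgreeBelow (suc K) α β
  AgreeBelow-suc agree eq k k<1+K with ℕP.m<1+n⇒m<n∨m≡n k<1+K
  ... | inj₁ k<K  = agree k k<K
  ... | inj₂ refl = eq

  firstDifference : ∀ {α β} → (∀ i → α i <ᴬ β i ⊎ α i ≡ β i ⊎ β i <ᴬ α i) →
                    ∀ K → AgreeBelow K α β ⊎ α ≺ω β ⊎ β ≺ω α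
  firstDifference cmp zero = inj₁ (λ _ ())
  firstDifference cmp (suc K) with firstDifference cmp K
  ... | inj₂ differ = inj₂ differ
  ... | inj₁ agree with cmp K
  ...   | inj₁ lt        = inj₂ (inj₁ (K , agree , lt))
  ...   | inj₂ (inj₁ eq) = inj₁ (AgreeBelow-suc agree eq)
  ...   | inj₂ (inj₂ gt) = inj₂ (inj₂ (K , (λ k k<K → sym (agree k k<K)) , gt))

  ≺ω-respˡ-agreement : ∀ {α α' β} (p : α ≺ω β) → (∀ k → k ≤ proj₁ p → α' k ≡ α k) → α' ≺ω β
  ≺ω-respˡ-agreement (i , agree , lt) e =
    i , (λ k k<i → trans (e k (ℕP.<⇒≤ k<i)) (agree k k<i)) , subst (_<ᴬ _) (sym (e i ℕP.≤-refl)) lt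

  ≺ω-respʳ-agreement : ∀ {α β β'} (p : α ≺ω β) → (∀ k → k ≤ proj₁ p → β' k ≡ β k) → α ≺ω β'
  ≺ω-respʳ-agreement (i , agree , lt) e =
    i , (λ k k<i → trans (agree k k<i) (sym (e k (ℕP.<⇒≤ k<i)))) , subst (_ <ᴬ_) (sym (e i ℕP.≤-refl)) lt

  ≺ω-unshift : ∀ {α β} L → AgreeBelow L α β → shift L α ≺ω shift L β → α ≺ω β
  ≺ω-unshift {α} {β} L agreeL (i , agree , lt) = L + i , agreeBelowL+i , lt
    where
      agreeBelowL+i : AgreeBelow (L + i) α β
      agreeBelowL+i k k<L+i with k ℕ.<? L
      ... | yes k<L = agreeL k k<L
      ... | no k≮L  = subst (λ j → α j ≡ β j) (ℕP.m+[n∸m]≡n L≤k)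
                        (agree (k ∸ L) (ℕP.+-cancelˡ-< L (k ∸ L) i
                          (subst (_< L + i) (sym (ℕP.m+[n∸m]≡n L≤k)) k<L+i)))
        where
          L≤k : L ≤ k
          L≤k = ℕP.≮⇒≥ k≮L

module LexStrictTotal {A : Set} {_<ᴬ_ : A → A → Set} (sto : IsStrictTotalOrder _≡_ _<ᴬ_) where
  open Lex _<ᴬ_
  open LexProperties _<ᴬ_
  open IsStrictTotalOrder sto using (compare) renaming (trans to <-trans; irrefl to <-irrefl)

  ≺ω-irrefl : ∀ {α} → ¬ α ≺ω α
  ≺ω-irrefl (_ , _ , lt) = <-irrefl refl lt

  ≺ω-trans : ∀ {α β γ} → α ≺ω β → β ≺ω γ → α ≺ω γ
  ≺ω-trans {α} {β} {γ} (i , agree , lt) (j , agree' , lt') with ℕP.<-cmp i j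
  ... | tri< i<j _ _ = i , (λ k k<i → trans (agree k k<i) (agree' k (ℕP.<-trans k<i i<j))) ,
                       subst (α i <ᴬ_) (agree' i i<j) lt
  ... | tri≈ _ refl _ = i , (λ k k<i → trans (agree k k<i) (agree' k k<i)) , <-trans lt lt'
  ... | tri> _ _ j<i = j , (λ k k<j → trans (agree k (ℕP.<-trans k<j j<i)) (agree' k k<j)) ,
                       subst (_<ᴬ γ j) (sym (agree j j<i)) lt'

  ≺ω-asym : ∀ {α β} → α ≺ω β → ¬ β ≺ω α
  ≺ω-asym p q = ≺ω-irrefl (≺ω-trans p q)

  ≺ω⇒≉ω : ∀ {α β} → α ≺ω β → ¬ α ≈ω β
  ≺ω⇒≉ω p e = ≺ω-irrefl (≺ω-resp-≈ω e ≈ω-refl p)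

  ⪯ω⇒⊁ω : ∀ {α β} → α ⪯ω β → ¬ β ≺ω α
  ⪯ω⇒⊁ω (inj₁ p) q = ≺ω-asym p q
  ⪯ω⇒⊁ω (inj₂ e) q = ≺ω⇒≉ω q (≈ω-sym e)

  ⪯ω-≺ω-trans : ∀ {α β γ} → α ⪯ω β → β ≺ω γ → α ≺ω γ
  ⪯ω-≺ω-trans (inj₁ p) q = ≺ω-trans p q
  ⪯ω-≺ω-trans (inj₂ e) q = ≺ω-resp-≈ω (≈ω-sym e) ≈ω-refl q

  ≺ω-compare : ∀ K α β → AgreeBelow K α β ⊎ α ≺ω β ⊎ β ≺ω α
  ≺ω-compare K α β = firstDifference cmp K
    where
      cmp : ∀ i → α i <ᴬ β i ⊎ α i ≡ β i ⊎ β i <ᴬ α i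
      cmp i with compare (α i) (β i)
      ... | tri< lt _ _ = inj₁ lt
      ... | tri≈ _ eq _ = inj₂ (inj₁ eq)
      ... | tri> _ _ gt = inj₂ (inj₂ gt)

  ≈ω-from-incomparable : ∀ {α β} → ¬ α ≺ω β → ¬ β ≺ω α → α ≈ω β
  ≈ω-from-incomparable {α} {β} α⊀β β⊀α i with ≺ω-compare (suc i) α β
  ... | inj₁ agree        = agree i (ℕP.n<1+n i)
  ... | inj₂ (inj₁ α≺β) = ⊥-elim (α⊀β α≺β)
  ... | inj₂ (inj₂ β≺α) = ⊥-elim (β⊀α β≺α)

  -- Constructively ¬ ξ ≺ω μ does not give μ ⪯ω ξ, but comparing up to the
  -- first difference of α and μ suffices.
  ≺ω-⊀ω-trans : ∀ {α μ ξ} → α ≺ω μ → ¬ ξ ≺ω μ → α ≺ω ξ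
  ≺ω-⊀ω-trans {α} {μ} {ξ} α≺μ@(j , _ , _) ξ⊀μ with ≺ω-compare (suc j) μ ξ
  ... | inj₁ agree = ≺ω-respʳ-agreement α≺μ (λ k k≤j → sym (agree k (s≤s k≤j)))
  ... | inj₂ (inj₁ μ≺ξ) = ≺ω-trans α≺μ μ≺ξ
  ... | inj₂ (inj₂ ξ≺μ) = ⊥-elim (ξ⊀μ ξ≺μ)

  shift-≺ω : ∀ {α β} L → AgreeBelow L α β → α ≺ω β → shift L α ≺ω shift L β
  shift-≺ω {α} {β} L agreeL (i , agree , lt) with i ℕ.<? L
  ... | yes i<L = ⊥-elim (<-irrefl (agreeL i i<L) lt)
  ... | no i≮L  = i ∸ L , agreeShifted , subst (λ j → α j <ᴬ β j) (sym L+[i∸L]≡i) lt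
    where
      L+[i∸L]≡i : L + (i ∸ L) ≡ i
      L+[i∸L]≡i = ℕP.m+[n∸m]≡n (ℕP.≮⇒≥ i≮L)
      agreeShifted : AgreeBelow (i ∸ L) (shift L α) (shift L β)
      agreeShifted k k<i∸L = agree (L + k) (subst (L + k <_) L+[i∸L]≡i (ℕP.+-monoʳ-< L k<i∸L))

module TauProperties (G : Graph) where
  open Graph G using (m)
  open GraphOps G
  open LexProperties (Fin._<_ {m})
  open LexStrictTotal (FinP.<-isStrictTotalOrder {m})

  constant : Fin m → Str
  constant c _ = c

  Tau-resp-≈ω : ∀ {α β} k → α ≈ω β → Tau α k → Tau β k
  Tau-resp-≈ω 1 e τα = ≺ω-resp-≈ω (e ∘ suc) e τα
  Tau-resp-≈ω 2 e τα = ≈ω-trans (≈ω-sym (e ∘ suc)) (≈ω-trans τα e)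
  Tau-resp-≈ω 3 e τα = ≺ω-resp-≈ω e (e ∘ suc) τα

  Tau-range : ∀ {α} k → Tau α k → k ≡ 1 ⊎ k ≡ 2 ⊎ k ≡ 3
  Tau-range 1 _ = inj₁ refl
  Tau-range 2 _ = inj₂ (inj₁ refl)
  Tau-range 3 _ = inj₂ (inj₂ refl)

  Tau-<2 : ∀ {α} k → Tau α k → k < 2 → Tau α 1
  Tau-<2 1 τα _ = τα
  Tau-<2 (suc (suc _)) _ (s≤s (s≤s ()))

  private
    constantPrefix : ∀ α j → AgreeBelow j (tail α) α → ∀ q → q ≤ j → α q ≡ α 0
    constantPrefix α j agree zero    _     = refl
    constantPrefix α j agree (suc q) 1+q≤j = trans (agree q 1+q≤j) (constantPrefix α j agree q (ℕP.<⇒≤ 1+q≤j))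

  -- Defined by projections, so that the position of the result reduces to suc (proj₁ τα).
  Tau1⇒≺ω-constant : ∀ α → Tau α 1 → α ≺ω constant (α 0)
  Tau1⇒≺ω-constant α τα =
    suc j , (λ k k<1+j → constantPrefix α j agree k (ℕP.≤-pred k<1+j)) ,
    subst (α (suc j) Fin.<_) (constantPrefix α j agree j ℕP.≤-refl) (proj₂ (proj₂ τα))
    where
      j = proj₁ τα
      agree = proj₁ (proj₂ τα)

  Tau2⇒≈ω-constant : ∀ α → Tau α 2 → α ≈ω constant (α 0)
  Tau2⇒≈ω-constant α e zero    = refl
  Tau2⇒≈ω-constant α e (suc q) = trans (e q) (Tau2⇒≈ω-constant α e q)

  Tau3⇒constant-≺ω : ∀ α → Tau α 3 → constant (α 0) ≺ω α
  Tau3⇒constant-≺ω α (j , agree , lt) =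
    suc j , (λ k k<1+j → sym (constantPrefix α j agree' k (ℕP.≤-pred k<1+j))) ,
    subst (Fin._< α (suc j)) (constantPrefix α j agree' j ℕP.≤-refl) lt
    where agree' = λ k k<j → sym (agree k k<j)

  Tau-<⇒≺ω : ∀ {α β} k k' → α 0 ≡ β 0 → Tau α k → Tau β k' → k < k' → α ≺ω β
  Tau-<⇒≺ω {α} {β} 1 2 e τα τβ _ =
    ≺ω-resp-≈ω ≈ω-refl (λ i → trans e (sym (Tau2⇒≈ω-constant β τβ i))) (Tau1⇒≺ω-constant α τα)
  Tau-<⇒≺ω {α} {β} 1 3 e τα τβ _ =
    ≺ω-trans (Tau1⇒≺ω-constant α τα) (≺ω-resp-≈ω (λ _ → sym e) ≈ω-refl (Tau3⇒constant-≺ω β τβ))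
  Tau-<⇒≺ω {α} {β} 2 3 e τα τβ _ =
    ≺ω-resp-≈ω (λ i → trans (sym e) (sym (Tau2⇒≈ω-constant α τα i))) ≈ω-refl (Tau3⇒constant-≺ω β τβ)
  Tau-<⇒≺ω 1 1 _ _ _ (s≤s ())
  Tau-<⇒≺ω 2 1 _ _ _ (s≤s ())
  Tau-<⇒≺ω 2 2 _ _ _ (s≤s (s≤s ()))
  Tau-<⇒≺ω 3 1 _ _ _ (s≤s ())
  Tau-<⇒≺ω 3 2 _ _ _ (s≤s (s≤s ()))
  Tau-<⇒≺ω 3 3 _ _ _ (s≤s (s≤s (s≤s ())))

  Tau1-shift : ∀ {α} (τα : Tau α 1) K → K ≤ proj₁ τα → Tau (shift K α) 1
  Tau1-shift {α} τα@(j , agree , _) K K≤j =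
    ≺ω-resp-≈ω (λ i → cong α (sym (ℕP.+-suc K i))) ≈ω-refl
      (shift-≺ω K (λ k k<K → agree k (ℕP.<-≤-trans k<K K≤j)) τα)

  Tau-unique : ∀ {α} k k' → Tau α k → Tau α k' → k ≡ k'
  Tau-unique k k' τk τk' with ℕP.<-cmp k k'
  ... | tri< k<k' _ _ = ⊥-elim (≺ω-irrefl (Tau-<⇒≺ω k k' refl τk τk' k<k'))
  ... | tri≈ _ k≡k' _ = k≡k'
  ... | tri> _ _ k'<k = ⊥-elim (≺ω-irrefl (Tau-<⇒≺ω k' k refl τk' τk k'<k))

splice : {A : Set} → ℕ → (ℕ → A) → (ℕ → A) → ℕ → A
splice k f g i with i ℕ.<? k
... | yes _ = f i
... | no _  = g (i ∸ k)

splice-< : {A : Set} (k : ℕ) (f g : ℕ → A) {i : ℕ} → i < k → splice k f g i ≡ f i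
splice-< k f g {i} i<k with i ℕ.<? k
... | yes _  = refl
... | no i≮k = ⊥-elim (i≮k i<k)

splice-≥ : {A : Set} (k : ℕ) (f g : ℕ → A) {i : ℕ} → k ≤ i → splice k f g i ≡ g (i ∸ k)
splice-≥ k f g {i} k≤i with i ℕ.<? k
... | yes i<k = ⊥-elim (ℕP.<⇒≱ i<k k≤i)
... | no _    = refl

splice-+ : {A : Set} (k : ℕ) (f g : ℕ → A) (i : ℕ) → splice k f g (k + i) ≡ g i
splice-+ k f g i = trans (splice-≥ k f g (ℕP.m≤m+n k i)) (cong g (ℕP.m+n∸m≡n k i))

infixr 5 _∷ω_
_∷ω_ : {A : Set} → A → (ℕ → A) → ℕ → A
(c ∷ω β) zero    = c
(c ∷ω β) (suc i) = β i

module Walks (G : Graph) where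
  open Graph G
  open GraphOps G
  open LexProperties (Fin._<_ {m})

  -- Runs against the edges and reads s 0 … s (k-1); the label of w is not read.
  Walk : Fin n → Fin n → ℕ → Str → Set
  Walk x w k s = Σ (ℕ → Fin n) λ ws → ws 0 ≡ x × ws k ≡ w ×
    (∀ j → j < k → E (ws (suc j)) (ws j) ≡ true) × (∀ j → j < k → lab (ws j) ≡ s j)

  Occurrence-take : ∀ {u α} (occ : Occurrence u α) k → Walk u (proj₁ occ k) k α
  Occurrence-take (us , us0 , edges , labels) k = us , us0 , refl , (λ j _ → edges j) , (λ j _ → labels j)

  Occurrence-drop : ∀ {u α} (occ : Occurrence u α) k → Occurrence (proj₁ occ k) (shift k α)
  Occurrence-drop (us , _ , edges , labels) k =
    (λ i → us (k + i)) , cong us (ℕP.+-identityʳ k) ,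
    (λ i → subst (λ j → E (us j) (us (k + i)) ≡ true) (sym (ℕP.+-suc k i)) (edges (k + i))) ,
    (λ i → labels (k + i))

  Occurrence-cons : ∀ {y z β} → E y z ≡ true → Occurrence y β → Occurrence z (lab z ∷ω β)
  Occurrence-cons {z = z} edge (vs , vs0 , edges , labels) = z ∷ω vs , refl , edges' , labels'
    where
      edges' : ∀ i → E ((z ∷ω vs) (suc i)) ((z ∷ω vs) i) ≡ true
      edges' zero    = subst (λ v → E v z ≡ true) (sym vs0) edge
      edges' (suc i) = edges i
      labels' : ∀ i → lab ((z ∷ω vs) i) ≡ (lab z ∷ω _) i
      labels' zero    = refl
      labels' (suc i) = labels i

  Walk-snoc : ∀ {x w w' k s} → Walk x w k s → lab w ≡ s k → E w' w ≡ true → Walk x w' (suc k) s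
  Walk-snoc {w' = w'} {k} {s} (ws , ws0 , wsk , edges , labels) labw edge =
    ws' , trans (ws'≡ws z≤n) ws0 , splice-≥ (suc k) ws _ ℕP.≤-refl , edges' , labels'
    where
      ws' = splice (suc k) ws (λ _ → w')
      ws'≡ws : ∀ {j} → j ≤ k → ws' j ≡ ws j
      ws'≡ws j≤k = splice-< (suc k) ws _ (s≤s j≤k)
      edges' : ∀ j → j < suc k → E (ws' (suc j)) (ws' j) ≡ true
      edges' j j<1+k with ℕP.m<1+n⇒m<n∨m≡n j<1+k
      ... | inj₁ j<k  = subst₂ (λ a b → E a b ≡ true) (sym (ws'≡ws j<k)) (sym (ws'≡ws (ℕP.<⇒≤ j<k))) (edges j j<k)
      ... | inj₂ refl = subst₂ (λ a b → E a b ≡ true) (sym (splice-≥ (suc k) ws _ ℕP.≤-refl))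
                          (sym (trans (ws'≡ws ℕP.≤-refl) wsk)) edge
      labels' : ∀ j → j < suc k → lab (ws' j) ≡ s j
      labels' j j<1+k with ℕP.m<1+n⇒m<n∨m≡n j<1+k
      ... | inj₁ j<k  = trans (cong lab (ws'≡ws (ℕP.<⇒≤ j<k))) (labels j j<k)
      ... | inj₂ refl = trans (cong lab (trans (ws'≡ws ℕP.≤-refl) wsk)) labw

  Walk-++-Occurrence : ∀ {x w k s β} → Walk x w k s → Occurrence w β → Occurrence x (splice k s β)
  Walk-++-Occurrence {x} {w} {k} {s} {β} (ws , ws0 , wsk , edges , labels) (vs , vs0 , edges' , labels') =
    qs , qs0 , qs-edges , qs-labels
    where
      qs = splice k ws vs
      qs0 : qs 0 ≡ x
      qs0 with 0 ℕ.<? k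
      ... | yes 0<k = ws0
      ... | no 0≮k  = trans (cong vs (ℕP.0∸n≡0 k))
                        (trans vs0 (trans (sym wsk) (trans (cong ws (ℕP.n≤0⇒n≡0 (ℕP.≮⇒≥ 0≮k))) ws0)))
      qs-edges : ∀ i → E (qs (suc i)) (qs i) ≡ true
      qs-edges i with ℕP.<-cmp (suc i) k
      ... | tri< 1+i<k _ _ = subst₂ (λ a b → E a b ≡ true) (sym (splice-< k ws vs 1+i<k))
                               (sym (splice-< k ws vs i<k)) (edges i i<k)
        where
          i<k : i < k
          i<k = ℕP.<-trans (ℕP.n<1+n i) 1+i<k
      ... | tri≈ _ refl _ = subst₂ (λ a b → E a b ≡ true)
                               (trans wsk (sym (trans (splice-≥ k ws vs ℕP.≤-refl)
                                                      (trans (cong vs (ℕP.n∸n≡0 (suc i))) vs0))))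
                               (sym (splice-< k ws vs (ℕP.n<1+n i))) (edges i (ℕP.n<1+n i))
      ... | tri> _ _ k<1+i = subst₂ (λ a b → E a b ≡ true)
                               (sym (trans (splice-≥ k ws vs (ℕP.<⇒≤ k<1+i)) (cong vs (ℕP.+-∸-assoc 1 k≤i))))
                               (sym (splice-≥ k ws vs k≤i)) (edges' (i ∸ k))
        where
          k≤i : k ≤ i
          k≤i = ℕP.≤-pred k<1+i
      qs-labels : ∀ i → lab (qs i) ≡ splice k s β i
      qs-labels i with i ℕ.<? k
      ... | yes i<k = labels i i<k
      ... | no _    = labels' (i ∸ k)

module Minima (G : Graph) (D : MinData G) where
  open Graph G
  open GraphOps G
  open MinData D
  open LexProperties (Fin._<_ {m})
  open LexStrictTotal (FinP.<-isStrictTotalOrder {m})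
  open Walks G

  mn-occurrence : ∀ u → Occurrence u (mn u)
  mn-occurrence u = proj₁ (mn-isMin u)

  mn-minimal : ∀ u {β} → Occurrence u β → ¬ β ≺ω mn u
  mn-minimal u occ = ⪯ω⇒⊁ω (proj₂ (mn-isMin u) _ occ)

  lab≡mn0 : ∀ u → lab u ≡ mn u 0
  lab≡mn0 u with mn-occurrence u
  ... | (_ , us0 , _ , labels) = trans (cong lab (sym us0)) (labels 0)

  -- A smaller string at the k-th node would give a smaller string at u after
  -- prepending the first k nodes.
  mn-suffix : ∀ {u} (occ : Occurrence u (mn u)) k → mn (proj₁ occ k) ≈ω shift k (mn u)
  mn-suffix {u} occ k with proj₂ (mn-isMin (proj₁ occ k)) _ (Occurrence-drop occ k)
  ... | inj₂ e  = e
  ... | inj₁ lt = ⊥-elim (mn-minimal u (Walk-++-Occurrence (Occurrence-take occ k) (mn-occurrence v))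
                    (≺ω-unshift k (λ j j<k → splice-< k (mn u) (mn v) j<k)
                      (≺ω-resp-≈ω (λ i → sym (splice-+ k (mn u) (mn v) i)) ≈ω-refl lt)))
    where v = proj₁ occ k

module SubsetProperties (G : Graph) (D : MinData G) where
  open Graph G
  open Derived G D

  T-not-∨ : ∀ {a b} → T (not a ∨ b) → T a → T b
  T-not-∨ {true} tb _ = tb

  T-not-∨-intro : ∀ {a b} → (T a → T b) → T (not a ∨ b)
  T-not-∨-intro {true}  f = f _
  T-not-∨-intro {false} _ = _

  allV⁻ : ∀ {p} → T (allV p) → ∀ x → T (p x)
  allV⁻ {p} h x = All.lookup (all⁺ p (allFin n) h) (∈-allFin x)

  allV⁺ : ∀ {p} → (∀ x → T (p x)) → T (allV p)
  allV⁺ {p} f = all⁻ p {allFin n} (All.tabulate (λ {x} _ → f x))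

  anyV⁻ : ∀ {p} → T (anyV p) → ∃ λ x → T (p x)
  anyV⁻ {p} h = Any.satisfied (any⁻ p (allFin n) h)

  anyV⁺ : ∀ {p} x → T (p x) → T (anyV p)
  anyV⁺ {p} x px = any⁺ p (lose (∈-allFin x) px)

  _∈ₛ_ : Fin n → Subset → Set
  x ∈ₛ S = T (S x)

  ∈-argmin⇔ : ∀ (R : Subset) (P : Fin n → Fin n → Bool) v →
              T (R v ∧ allV (λ w → not (R w) ∨ P v w)) ⇔ (v ∈ₛ R × (∀ w → w ∈ₛ R → T (P v w)))
  ∈-argmin⇔ R P v = mk⇔
    (λ h → let (v∈R , minimal) = Equivalence.to T-∧ h in v∈R , λ w → T-not-∨ (allV⁻ minimal w))
    (λ (v∈R , minimal) → Equivalence.from T-∧ (v∈R , allV⁺ (λ w → T-not-∨-intro (minimal w))))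

  argminLab⇔ : ∀ R v → v ∈ₛ argminLab R ⇔ (v ∈ₛ R × (∀ w → w ∈ₛ R → toℕ (lab v) ≤ toℕ (lab w)))
  argminLab⇔ R v = mk⇔
    (λ h → let (v∈R , minimal) = Equivalence.to (∈-argmin⇔ R (λ v w → lab v ≤Σᵇ lab w) v) h in
           v∈R , λ w w∈R → ℕP.≤ᵇ⇒≤ _ _ (minimal w w∈R))
    (λ (v∈R , minimal) → Equivalence.from (∈-argmin⇔ R (λ v w → lab v ≤Σᵇ lab w) v)
                           (v∈R , λ w w∈R → ℕP.≤⇒≤ᵇ (minimal w w∈R)))

  F⇔ : ∀ R v → v ∈ₛ F R ⇔ (v ∈ₛ argminLab R × (∀ w → w ∈ₛ argminLab R → τ v ≤ τ w))
  F⇔ R v = mk⇔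
    (λ h → let (v∈R' , minimal) = Equivalence.to (∈-argmin⇔ (argminLab R) (λ v w → τ v ℕ.≤ᵇ τ w) v) h in
           v∈R' , λ w w∈R' → ℕP.≤ᵇ⇒≤ _ _ (minimal w w∈R'))
    (λ (v∈R' , minimal) → Equivalence.from (∈-argmin⇔ (argminLab R) (λ v w → τ v ℕ.≤ᵇ τ w) v)
                            (v∈R' , λ w w∈R' → ℕP.≤⇒≤ᵇ (minimal w w∈R')))

  ∈-preds⇔ : ∀ S y → y ∈ₛ preds S ⇔ ∃ λ z → z ∈ₛ S × E y z ≡ true
  ∈-preds⇔ S y = mk⇔
    (λ h → let (z , h') = anyV⁻ h ; (z∈S , edge) = Equivalence.to T-∧ h' in z , z∈S , Equivalence.to T-≡ edge)
    (λ (z , z∈S , edge) → anyV⁺ z (Equivalence.from T-∧ (z∈S , Equivalence.from T-≡ edge)))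

  ∈-single : ∀ {u w} → w ∈ₛ single u → u ≡ w
  ∈-single = toWitness

  ∈-single-self : ∀ u → u ∈ₛ single u
  ∈-single-self u = fromWitness refl

  ∈-∖ₛ⁻ : ∀ S U {x} → x ∈ₛ (S ∖ₛ U) → x ∈ₛ S × ¬ x ∈ₛ U
  ∈-∖ₛ⁻ S U {x} h with S x | U x
  ... | true | false = _ , λ ()

  ∈-∖ₛ⁺ : ∀ S U {x} → x ∈ₛ S → ¬ x ∈ₛ U → x ∈ₛ (S ∖ₛ U)
  ∈-∖ₛ⁺ S U {x} x∈S x∉U with S x | U x
  ... | true | false = _
  ... | true | true  = x∉U _

  ∈-∪ₛ⁻ : ∀ S U {x} → x ∈ₛ (S ∪ₛ U) → x ∈ₛ S ⊎ x ∈ₛ U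
  ∈-∪ₛ⁻ S U = Equivalence.to T-∨

  τOfFirst-filter : ∀ S c → (∀ z → z ∈ₛ S → τ z ≡ c) →
                    ∀ {z} xs → z ∈ xs → z ∈ₛ S → τOfFirst (filterᵇ S xs) ≡ c
  τOfFirst-filter S c all-c (x ∷ xs) z∈xs z∈S with S x in eq
  ... | true = all-c x (Equivalence.from T-≡ eq)
  τOfFirst-filter S c all-c (x ∷ xs) (here refl) z∈S | false = ⊥-elim (subst T eq z∈S)
  τOfFirst-filter S c all-c (x ∷ xs) (there z∈xs) z∈S | false = τOfFirst-filter S c all-c xs z∈xs z∈S

  Gseq-suc : ∀ u k → let Gk = proj₁ (Gseq u k) ; Uk = proj₂ (Gseq u k) in
             Gseq u (suc k) ≡ (F (preds Gk) ∖ₛ Uk , Uk ∪ₛ (F (preds Gk) ∖ₛ Uk))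
  Gseq-suc u k with Gseq u k
  ... | _ = refl

module GreedySequence (G : Graph) (D : MinData G) (u : Fin (Graph.n G)) (hu : MinData.τ D u ≡ 3) where
  open Graph G
  open Derived G D
  open LexProperties (Fin._<_ {m})
  open LexStrictTotal (FinP.<-isStrictTotalOrder {m})
  open TauProperties G
  open Walks G
  open Minima G D
  open SubsetProperties G D

  α : Str
  α = mn u

  occurrence : Occurrence u α
  occurrence = proj₁ (proj₂ (ℓ-spec u hu))

  us : ℕ → Fin n
  us = proj₁ occurrence

  2≤ℓ : 2 ≤ ℓ u
  2≤ℓ = proj₁ (ℓ-spec u hu)

  Tau-suffix : ∀ k → Tau (shift k α) (τ (us k))
  Tau-suffix k = Tau-resp-≈ω _ (mn-suffix occurrence k) (τ-spec (us k))

  Tau1-before-ℓ : ∀ j → 2 ≤ j → j < ℓ u → Tau (shift (j ∸ 1) α) 1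
  Tau1-before-ℓ j 2≤j j<ℓ = Tau-<2 _ (Tau-suffix (j ∸ 1)) (proj₂ (proj₂ (proj₂ (ℓ-spec u hu))) j 2≤j j<ℓ)

  shift-suc-≺ω : ∀ p → 1 ≤ p → suc p < ℓ u → shift (suc p) α ≺ω shift p α
  shift-suc-≺ω p 1≤p 1+p<ℓ =
    ≺ω-resp-≈ω (λ i → cong α (ℕP.+-suc p i)) ≈ω-refl (Tau1-before-ℓ (suc p) (s≤s 1≤p) 1+p<ℓ)

  shift-decreasing : ∀ j q → 1 ≤ j → j ≤ q → suc q < ℓ u → shift (suc q) α ≺ω shift j α
  shift-decreasing j zero    1≤j j≤0   _      = ⊥-elim (ℕP.<⇒≱ 1≤j j≤0)
  shift-decreasing j (suc q) 1≤j j≤1+q 2+q<ℓ with ℕP.m≤n⇒m<n∨m≡n j≤1+q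
  ... | inj₂ refl  = shift-suc-≺ω j 1≤j 2+q<ℓ
  ... | inj₁ j<1+q = ≺ω-trans (shift-suc-≺ω (suc q) (s≤s z≤n) 2+q<ℓ)
                       (shift-decreasing j q 1≤j (ℕP.≤-pred j<1+q) (ℕP.<-trans (ℕP.n<1+n _) 2+q<ℓ))

  -- layer k is G_{k+1}(u) and visited k is G_2(u) ∪ … ∪ G_{k+1}(u).
  layer visited : ℕ → Subset
  layer k   = proj₁ (Gseq u k)
  visited k = proj₂ (Gseq u k)

  layer-suc : ∀ k → layer (suc k) ≡ F (preds (layer k)) ∖ₛ visited k
  layer-suc k = cong proj₁ (Gseq-suc u k)

  visited-suc : ∀ k → visited (suc k) ≡ visited k ∪ₛ layer (suc k)
  visited-suc k = trans (cong proj₂ (Gseq-suc u k)) (cong (visited k ∪ₛ_) (sym (layer-suc k)))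

  record Invariant (k : ℕ) : Set where
    field
      reached         : ∀ z → z ∈ₛ layer k → Walk u z k α × lab z ≡ α k
      not-below       : ∀ z → z ∈ₛ layer k → ¬ mn z ≺ω shift k α
      continuation    : ∃ λ z → z ∈ₛ layer k × mn z ≈ω shift k α
      τ-layer         : ∀ z → z ∈ₛ layer k → τ z ≡ τ (us k)
      visited-earlier : ∀ z → z ∈ₛ visited k → ∃ λ j → 1 ≤ j × j ≤ k × ¬ mn z ≺ω shift j α

  Invariant-zero : Invariant 0
  Invariant-zero = record
    { reached         = λ z z∈ → subst (λ z → Walk u z 0 α × lab z ≡ α 0) (∈-single z∈)
                                   (((λ _ → u) , refl , refl , (λ _ ()) , (λ _ ())) , lab≡mn0 u)
    ; not-below       = λ z z∈ → subst (λ z → ¬ mn z ≺ω α) (∈-single z∈) ≺ω-irrefl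
    ; continuation    = u , ∈-single-self u , ≈ω-refl
    ; τ-layer         = λ z z∈ → trans (cong τ (sym (∈-single z∈))) (cong τ (sym (proj₁ (proj₂ occurrence))))
    ; visited-earlier = λ _ ()
    }

  module Step (k : ℕ) (1+k<ℓ : suc k < ℓ u) (I : Invariant k) where
    open Invariant I

    R : Subset
    R = preds (layer k)

    -- y* continues the occurrence of the minimum through the continuation node of layer k.
    z* y* : Fin n
    z* = proj₁ continuation
    y* = proj₁ (mn-occurrence z*) 1

    mn-y* : mn y* ≈ω shift (suc k) α
    mn-y* i = trans (mn-suffix (mn-occurrence z*) 1 i)
                    (trans (proj₂ (proj₂ continuation) (suc i)) (cong α (ℕP.+-suc k i)))

    lab-y* : lab y* ≡ α (suc k)
    lab-y* = trans (lab≡mn0 y*) (trans (mn-y* 0) (cong α (ℕP.+-identityʳ (suc k))))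

    y*∈R : y* ∈ₛ R
    y*∈R = Equivalence.from (∈-preds⇔ (layer k) y*)
             (z* , proj₁ (proj₂ continuation) ,
              subst (λ z → E y* z ≡ true) (proj₁ (proj₂ (mn-occurrence z*)))
                (proj₁ (proj₂ (proj₂ (mn-occurrence z*))) 0))

    -- Through the edge from y to z ∈ layer k, the string α k ∷ω mn y occurs at z.
    R-not-below : ∀ y → y ∈ₛ R → ¬ mn y ≺ω shift (suc k) α
    R-not-below y y∈R lt with Equivalence.to (∈-preds⇔ (layer k) y) y∈R
    ... | (z , z∈ , edge) =
      not-below z z∈ (⪯ω-≺ω-trans (proj₂ (mn-isMin z) _ (Occurrence-cons edge (mn-occurrence y)))
        (≺ω-unshift 1 head-agrees (≺ω-resp-≈ω ≈ω-refl (λ i → cong α (sym (ℕP.+-suc k i))) lt)))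
      where
        head-agrees : AgreeBelow 1 (lab z ∷ω mn y) (shift k α)
        head-agrees zero    _         = trans (proj₂ (reached z z∈)) (cong α (sym (ℕP.+-identityʳ k)))
        head-agrees (suc _) (s≤s ())

    R-label-≥ : ∀ y → y ∈ₛ R → toℕ (α (suc k)) ≤ toℕ (lab y)
    R-label-≥ y y∈R = ℕP.≮⇒≥ λ lt → R-not-below y y∈R
      (0 , (λ _ ()) , subst₂ (λ a b → toℕ a ℕ.< toℕ b) (lab≡mn0 y) (cong α (sym (ℕP.+-identityʳ (suc k)))) lt)

    label-minimal : ∀ w → w ∈ₛ argminLab R → lab w ≡ α (suc k)
    label-minimal w w∈R' with Equivalence.to (argminLab⇔ R w) w∈R'
    ... | (w∈R , minimal) = FinP.toℕ-injective (ℕP.≤-antisym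
          (subst (λ c → toℕ (lab w) ≤ toℕ c) lab-y* (minimal y* y*∈R)) (R-label-≥ w w∈R))

    y*∈R' : y* ∈ₛ argminLab R
    y*∈R' = Equivalence.from (argminLab⇔ R y*)
              (y*∈R , λ w w∈R → subst (λ c → toℕ c ≤ toℕ (lab w)) (sym lab-y*) (R-label-≥ w w∈R))

    τ-y* : τ y* ≡ τ (us (suc k))
    τ-y* = Tau-unique _ _ (Tau-resp-≈ω (τ y*) mn-y* (τ-spec y*)) (Tau-suffix (suc k))

    -- A node of R' with smaller τ would, sharing its first letter with y*, have a smaller minimum.
    τ-y*-minimal : ∀ w → w ∈ₛ argminLab R → τ y* ≤ τ w
    τ-y*-minimal w w∈R' = ℕP.≮⇒≥ λ τw<τy* → R-not-below w (proj₁ (Equivalence.to (argminLab⇔ R w) w∈R'))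
      (≺ω-resp-≈ω ≈ω-refl mn-y* (Tau-<⇒≺ω (τ w) (τ y*) same-head (τ-spec w) (τ-spec y*) τw<τy*))
      where same-head = trans (sym (lab≡mn0 w)) (trans (label-minimal w w∈R') (trans (sym lab-y*) (lab≡mn0 y*)))

    y*∉visited : ¬ y* ∈ₛ visited k
    y*∉visited y*∈ with visited-earlier y* y*∈
    ... | (j , 1≤j , j≤k , y*⊀) =
      y*⊀ (≺ω-resp-≈ω (≈ω-sym mn-y*) ≈ω-refl (shift-decreasing j k 1≤j j≤k 1+k<ℓ))

    y*∈layer : y* ∈ₛ layer (suc k)
    y*∈layer = subst (λ S → y* ∈ₛ S) (sym (layer-suc k))
                 (∈-∖ₛ⁺ (F R) (visited k) (Equivalence.from (F⇔ R y*) (y*∈R' , τ-y*-minimal)) y*∉visited)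

    layer-∈F : ∀ z → z ∈ₛ layer (suc k) → z ∈ₛ F R
    layer-∈F z z∈ = proj₁ (∈-∖ₛ⁻ (F R) (visited k) (subst (λ S → z ∈ₛ S) (layer-suc k) z∈))

    layer-∈R : ∀ z → z ∈ₛ layer (suc k) → z ∈ₛ R
    layer-∈R z z∈ = proj₁ (Equivalence.to (argminLab⇔ R z) (proj₁ (Equivalence.to (F⇔ R z) (layer-∈F z z∈))))

    Invariant-suc : Invariant (suc k)
    Invariant-suc = record
      { reached         = reached'
      ; not-below       = λ z z∈ → R-not-below z (layer-∈R z z∈)
      ; continuation    = y* , y*∈layer , mn-y*
      ; τ-layer         = τ-layer'
      ; visited-earlier = visited-earlier'
      }
      where
        reached' : ∀ z → z ∈ₛ layer (suc k) → Walk u z (suc k) α × lab z ≡ α (suc k)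
        reached' z z∈ with Equivalence.to (∈-preds⇔ (layer k) z) (layer-∈R z z∈)
        ... | (z₀ , z₀∈ , edge) = Walk-snoc (proj₁ (reached z₀ z₀∈)) (proj₂ (reached z₀ z₀∈)) edge ,
                                  label-minimal z (proj₁ (Equivalence.to (F⇔ R z) (layer-∈F z z∈)))
        τ-layer' : ∀ z → z ∈ₛ layer (suc k) → τ z ≡ τ (us (suc k))
        τ-layer' z z∈ with Equivalence.to (F⇔ R z) (layer-∈F z z∈)
        ... | (z∈R' , minimal) = trans (ℕP.≤-antisym (minimal y* y*∈R') (τ-y*-minimal z z∈R')) τ-y*
        visited-earlier' : ∀ z → z ∈ₛ visited (suc k) → ∃ λ j → 1 ≤ j × j ≤ suc k × ¬ mn z ≺ω shift j α
        visited-earlier' z z∈ with ∈-∪ₛ⁻ (visited k) (layer (suc k)) (subst (λ S → z ∈ₛ S) (visited-suc k) z∈)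
        ... | inj₁ z∈visited = let (j , 1≤j , j≤k , z⊀) = visited-earlier z z∈visited
                               in j , 1≤j , ℕP.m≤n⇒m≤1+n j≤k , z⊀
        ... | inj₂ z∈layer   = suc k , s≤s z≤n , ℕP.≤-refl , R-not-below z (layer-∈R z z∈layer)

  invariant : ∀ k → k < ℓ u → Invariant k
  invariant zero    _     = Invariant-zero
  invariant (suc k) 1+k<ℓ = Step.Invariant-suc k 1+k<ℓ (invariant k (ℕP.<-trans (ℕP.n<1+n k) 1+k<ℓ))

  ℓ-1 : ℕ
  ℓ-1 = ℓ u ∸ 1

  ℓ-1<ℓ : ℓ-1 < ℓ u
  ℓ-1<ℓ = ℕP.∸-monoʳ-< (s≤s z≤n) (ℕP.<⇒≤ 2≤ℓ)

  1≤ℓ-1 : 1 ≤ ℓ-1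
  1≤ℓ-1 = ℕP.∸-monoˡ-≤ 1 2≤ℓ

  last-layer : Invariant ℓ-1
  last-layer = invariant ℓ-1 ℓ-1<ℓ

  open Invariant last-layer public using () renaming (reached to last-layer-reached; continuation to last-layer-continuation)

  t≡τ : t u ≡ τ (us ℓ-1)
  t≡τ = τOfFirst-filter (layer ℓ-1) _ (Invariant.τ-layer last-layer) (allFin n)
          (∈-allFin _) (proj₁ (proj₂ (Invariant.continuation last-layer)))

  Tau-last : Tau (shift ℓ-1 α) (t u)
  Tau-last = subst (Tau (shift ℓ-1 α)) (sym t≡τ) (Tau-suffix ℓ-1)

  2≤t : 2 ≤ t u
  2≤t = subst (2 ≤_) (sym t≡τ) (proj₁ (proj₂ (proj₂ (ℓ-spec u hu))))

  plateau : t u ≡ 2 → ∀ q → α (ℓ-1 + q) ≡ α ℓ-1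
  plateau t≡2 q = trans (Tau2⇒≈ω-constant (shift ℓ-1 α) (subst (Tau (shift ℓ-1 α)) t≡2 Tau-last) q)
                        (cong α (ℕP.+-identityʳ ℓ-1))

  ¬Tau1-last : ¬ Tau (shift ℓ-1 α) 1
  ¬Tau1-last τ1 = ℕP.<⇒≱ (subst (_< 2) (Tau-unique 1 (t u) τ1 Tau-last) (ℕP.n<1+n 1)) 2≤t

  -- Otherwise α would descend at position ℓ_u - 1, that is t_u = 1.
  Tau1-witness-before-last : ∀ K (τK : Tau (shift K α) 1) → K ≤ ℓ-1 → K + suc (proj₁ τK) ≤ ℓ-1
  Tau1-witness-before-last K τK K≤ℓ-1 with ℓ-1 ∸ K ℕ.≤? proj₁ τK
  ... | yes ℓ-1∸K≤j =
    ⊥-elim (¬Tau1-last (Tau-resp-≈ω 1 (λ i → cong α (K+[ℓ-1∸K]+i i)) (Tau1-shift τK (ℓ-1 ∸ K) ℓ-1∸K≤j)))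
    where
      K+[ℓ-1∸K]+i : ∀ i → K + (ℓ-1 ∸ K + i) ≡ ℓ-1 + i
      K+[ℓ-1∸K]+i i = trans (sym (ℕP.+-assoc K (ℓ-1 ∸ K) i)) (cong (_+ i) (ℕP.m+[n∸m]≡n K≤ℓ-1))
  ... | no ℓ-1∸K≰j =
    subst (K + suc (proj₁ τK) ≤_) (ℕP.m+[n∸m]≡n K≤ℓ-1) (ℕP.+-monoʳ-≤ K (ℕP.≰⇒> ℓ-1∸K≰j))

  t≡2⊎t≡3 : t u ≡ 2 ⊎ t u ≡ 3
  t≡2⊎t≡3 with Tau-range (t u) Tau-last
  ... | inj₁ t≡1 = ⊥-elim (¬Tau1-last (subst (Tau (shift ℓ-1 α)) t≡1 Tau-last))
  ... | inj₂ t≡2⊎t≡3 = t≡2⊎t≡3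

nth : {A : Set} → List A → ℕ → A → A
nth []       _       d = d
nth (x ∷ _)  zero    _ = x
nth (_ ∷ xs) (suc p) d = nth xs p d

nth-applyUpTo : {A : Set} (f : ℕ → A) (n : ℕ) {p : ℕ} (d : A) → p < n → nth (applyUpTo f n) p d ≡ f p
nth-applyUpTo f (suc n) {zero}  d _         = refl
nth-applyUpTo f (suc n) {suc p} d (s≤s p<n) = nth-applyUpTo (f ∘ suc) n d p<n

module FinStrProperties (m : ℕ) where
  open FinStr (Fin._<_ {m})

  data FinStrComparison (a b : List (Fin m)) : Set where
    equal          : a ≡ b → FinStrComparison a b
    strict-prefix  : IsStrictPrefix a b → FinStrComparison a b
    strict-prefix⁻ : IsStrictPrefix b a → FinStrComparison a b
    precedes       : ¬ IsPrefix a b → a ≺fin b → FinStrComparison a b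
    precedes⁻      : ¬ IsPrefix b a → b ≺fin a → FinStrComparison a b

  compareFinStr : ∀ a b → FinStrComparison a b
  compareFinStr []       []       = equal refl
  compareFinStr []       (y ∷ ys) = strict-prefix (y , ys , refl)
  compareFinStr (x ∷ xs) []       = strict-prefix⁻ (x , xs , refl)
  compareFinStr (x ∷ xs) (y ∷ ys) with FinP.<-cmp x y
  ... | tri< x<y _ _ = precedes (λ (_ , e) → FinP.<-irrefl (∷-injectiveˡ e) x<y) (inj₁ x<y)
  ... | tri> _ _ y<x = precedes⁻ (λ (_ , e) → FinP.<-irrefl (∷-injectiveˡ e) y<x) (inj₁ y<x)
  ... | tri≈ _ refl _ with compareFinStr xs ys
  ...   | equal e                = equal (cong (x ∷_) e)
  ...   | strict-prefix (c , δ , e)  = strict-prefix (c , δ , cong (x ∷_) e)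
  ...   | strict-prefix⁻ (c , δ , e) = strict-prefix⁻ (c , δ , cong (x ∷_) e)
  ...   | precedes np lt         = precedes (λ (δ , e) → np (δ , ∷-injectiveʳ e)) (inj₂ (refl , lt))
  ...   | precedes⁻ np lt        = precedes⁻ (λ (δ , e) → np (δ , ∷-injectiveʳ e)) (inj₂ (refl , lt))

  ≺fin-position : ∀ a b d → ¬ IsPrefix a b → a ≺fin b →
    ∃ λ j → j < length a × j < length b × (∀ q → q < j → nth a q d ≡ nth b q d) × nth a j d Fin.< nth b j d
  ≺fin-position []       b        d np _         = ⊥-elim (np (b , refl))
  ≺fin-position (x ∷ xs) (y ∷ ys) d np (inj₁ x<y) = 0 , s≤s z≤n , s≤s z≤n , (λ _ ()) , x<y
  ≺fin-position (x ∷ xs) (y ∷ ys) d np (inj₂ (refl , lt))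
    with ≺fin-position xs ys d (λ (δ , e) → np (δ , cong (x ∷_) e)) lt
  ... | (j , j<∣xs∣ , j<∣ys∣ , agree , differ) = suc j , s≤s j<∣xs∣ , s≤s j<∣ys∣ , agree' , differ
    where
      agree' : ∀ q → q < suc j → nth (x ∷ xs) q d ≡ nth (x ∷ ys) q d
      agree' zero    _         = refl
      agree' (suc q) (s≤s q<j) = agree q q<j

  strict-prefix-shorter : ∀ {a b} → IsStrictPrefix a b → length a < length b
  strict-prefix-shorter {[]}     (_ , _ , refl) = s≤s z≤n
  strict-prefix-shorter {_ ∷ xs} (c , δ , refl) = s≤s (strict-prefix-shorter {xs} (c , δ , refl))

  strict-prefix-nth : ∀ {a b} d → IsStrictPrefix a b → ∀ q → q < length a → nth a q d ≡ nth b q d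
  strict-prefix-nth {x ∷ xs} d (c , δ , refl) zero    _         = refl
  strict-prefix-nth {x ∷ xs} d (c , δ , refl) (suc q) (s≤s q<n) = strict-prefix-nth {xs} d (c , δ , refl) q q<n

  strict-prefix-irrefl : ∀ {a} → ¬ IsStrictPrefix a a
  strict-prefix-irrefl sp = ℕP.<-irrefl refl (strict-prefix-shorter sp)

-- Expansion of a string of pairs (γ , x): a pair contributes all but the last
-- letter of γ and then, if x = 2, the last letter of γ forever.
module Expansion {A : Set} (d : A) where
  Label : Set
  Label = List A × ℕ

  body : Label → ℕ
  body (γs , _) = length γs ∸ 1

  letter : Label → ℕ → A
  letter l j = nth (proj₁ l) (j ⊓ body l) d

  Leaves : Label → ℕ → Set
  Leaves l j = ¬ proj₂ l ≡ 2 × body l ≤ j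

  leaves? : ∀ l j → Dec (Leaves l j)
  leaves? l j = ¬? (proj₂ l ℕ.≟ 2) ×-dec (body l ℕ.≤? j)

  -- the letter p positions after offset j in the block of a 0
  expandFrom : (ℕ → Label) → ℕ → ℕ → A
  expandFrom a j zero    = letter (a 0) j
  expandFrom a j (suc p) with leaves? (a 0) (suc j)
  ... | yes _ = expandFrom (a ∘ suc) 0 p
  ... | no _  = expandFrom a (suc j) p

  expand : (ℕ → Label) → ℕ → A
  expand a = expandFrom a 0

  expandFrom-stay : ∀ a j p → ¬ Leaves (a 0) (j + p) → expandFrom a j p ≡ letter (a 0) (j + p)
  expandFrom-stay a j zero    _     = cong (letter (a 0)) (sym (ℕP.+-identityʳ j))
  expandFrom-stay a j (suc p) stays with leaves? (a 0) (suc j)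
  ... | yes (t≢2 , body≤1+j) =
    ⊥-elim (stays (t≢2 , ℕP.≤-trans body≤1+j (subst (suc j ≤_) (sym (ℕP.+-suc j p)) (s≤s (ℕP.m≤m+n j p)))))
  ... | no _ = trans (expandFrom-stay a (suc j) p (subst (λ i → ¬ Leaves (a 0) i) (ℕP.+-suc j p) stays))
                     (cong (letter (a 0)) (sym (ℕP.+-suc j p)))

  expandFrom-leave : ∀ a j p → ¬ proj₂ (a 0) ≡ 2 → j < body (a 0) → body (a 0) ≤ j + p →
                     expandFrom a j p ≡ expandFrom (a ∘ suc) 0 (j + p ∸ body (a 0))
  expandFrom-leave a j zero    _   j<body body≤j+0 =
    ⊥-elim (ℕP.<⇒≱ j<body (subst (body (a 0) ≤_) (ℕP.+-identityʳ j) body≤j+0))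
  expandFrom-leave a j (suc p) t≢2 j<body body≤j+1+p with leaves? (a 0) (suc j)
  ... | yes (_ , body≤1+j) = cong (expandFrom (a ∘ suc) 0) (sym (begin
          j + suc p ∸ body (a 0) ≡⟨ cong (j + suc p ∸_) (ℕP.≤-antisym body≤1+j j<body) ⟩
          j + suc p ∸ suc j      ≡⟨ cong (_∸ suc j) (ℕP.+-suc j p) ⟩
          suc j + p ∸ suc j      ≡⟨ ℕP.m+n∸m≡n (suc j) p ⟩
          p                      ∎))
    where open ≡-Reasoning
  ... | no stays = trans (expandFrom-leave a (suc j) p t≢2 1+j<body (subst (body (a 0) ≤_) (ℕP.+-suc j p) body≤j+1+p))
                         (cong (λ i → expandFrom (a ∘ suc) 0 (i ∸ body (a 0))) (sym (ℕP.+-suc j p)))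
    where
      1+j<body : suc j < body (a 0)
      1+j<body = ℕP.≰⇒> (λ body≤1+j → stays (t≢2 , body≤1+j))

  expandFrom-agree : ∀ a b j p → (∀ k → k ≤ p → a k ≡ b k) → expandFrom a j p ≡ expandFrom b j p
  expandFrom-agree a b j zero    agree = cong (λ l → letter l j) (agree 0 z≤n)
  expandFrom-agree a b j (suc p) agree with leaves? (a 0) (suc j) | leaves? (b 0) (suc j)
  ... | yes _ | yes _ = expandFrom-agree (a ∘ suc) (b ∘ suc) 0 p (λ k k≤p → agree (suc k) (s≤s k≤p))
  ... | no _  | no _  = expandFrom-agree a b (suc j) p (λ k k≤p → agree k (ℕP.m≤n⇒m≤1+n k≤p))
  ... | yes a-leaves | no b-stays = ⊥-elim (b-stays (subst (λ l → Leaves l (suc j)) (agree 0 z≤n) a-leaves))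
  ... | no a-stays | yes b-leaves = ⊥-elim (a-stays (subst (λ l → Leaves l (suc j)) (sym (agree 0 z≤n)) b-leaves))

  expand-< : ∀ a p → p < body (a 0) → expand a p ≡ nth (proj₁ (a 0)) p d
  expand-< a p p<body = trans (expandFrom-stay a 0 p (λ (_ , body≤p) → ℕP.<⇒≱ p<body body≤p))
                              (cong (λ i → nth (proj₁ (a 0)) i d) (ℕP.m≤n⇒m⊓n≡m (ℕP.<⇒≤ p<body)))

  expand-2 : ∀ a p → proj₂ (a 0) ≡ 2 → body (a 0) ≤ p → expand a p ≡ nth (proj₁ (a 0)) (body (a 0)) d
  expand-2 a p t≡2 body≤p = trans (expandFrom-stay a 0 p (λ (t≢2 , _) → t≢2 t≡2))
                                  (cong (λ i → nth (proj₁ (a 0)) i d) (ℕP.m≥n⇒m⊓n≡n body≤p))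

  expand-leave : ∀ a p → ¬ proj₂ (a 0) ≡ 2 → 1 ≤ body (a 0) → body (a 0) ≤ p →
                 expand a p ≡ expand (a ∘ suc) (p ∸ body (a 0))
  expand-leave a p t≢2 1≤body body≤p = expandFrom-leave a 0 p t≢2 1≤body body≤p

  expand-agree : ∀ a b p → (∀ k → k ≤ p → a k ≡ b k) → expand a p ≡ expand b p
  expand-agree a b p = expandFrom-agree a b 0 p

-- The default letter d of nth is never read when expanding Ḡ-occurrences.
module Correspondence (G : Graph) (D : MinData G) (d : Fin (Graph.m G)) where
  open Graph G
  open Derived G D
  open LexProperties (Fin._<_ {m})
  open LexStrictTotal (FinP.<-isStrictTotalOrder {m})
  open TauProperties G
  open Walks G
  open Minima G D
  open SubsetProperties G D
  open FinStr (Fin._<_ {m})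
  open FinStrProperties m
  open Expansion d
  module Node (w̄ : V̄) = GreedySequence G D (proj₁ w̄) (proj₂ w̄)
  open Node using (ℓ-1; 1≤ℓ-1; ℓ-1<ℓ; t≡2⊎t≡3)

  length-γ : ∀ w → length (γ w) ≡ ℓ w
  length-γ w = trans (length-map (mn w) (upTo (ℓ w))) (length-upTo (ℓ w))

  body-λ̄ : ∀ w̄ → body (λ̄ w̄) ≡ ℓ-1 w̄
  body-λ̄ (w , _) = cong (_∸ 1) (length-γ w)

  nth-γ : ∀ w {p} → p < ℓ w → nth (γ w) p d ≡ mn w p
  nth-γ w p<ℓ = trans (cong (λ γs → nth γs _ d) (map-upTo (mn w) (ℓ w))) (nth-applyUpTo (mn w) (ℓ w) d p<ℓ)

  2≢3 : ¬ 2 ≡ 3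
  2≢3 ()

  Tau3-node : ∀ (z̄ : V̄) → constant (mn (proj₁ z̄) 0) ≺ω mn (proj₁ z̄)
  Tau3-node (z , τz≡3) = Tau3⇒constant-≺ω (mn z) (subst (Tau (mn z)) τz≡3 (τ-spec z))

  module OccurrenceFacts {x̄ : V̄} {a : ℕ → Label'} (o : Bar.Occurrence x̄ a) where
    x : Fin n
    x = proj₁ x̄

    L : ℕ
    L = ℓ-1 x̄

    ws : ℕ → V̄
    ws = proj₁ o

    next : V̄
    next = ws 1

    head : a 0 ≡ λ̄ x̄
    head = trans (sym (proj₂ (proj₂ (proj₂ o)) 0)) (cong λ̄ (proj₁ (proj₂ o)))

    body-head : body (a 0) ≡ L
    body-head = trans (cong body head) (body-λ̄ x̄)

    t-head : proj₂ (a 0) ≡ t x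
    t-head = cong proj₂ head

    tail-occurrence : Bar.Occurrence next (a ∘ suc)
    tail-occurrence = (ws ∘ suc) , refl , (proj₁ (proj₂ (proj₂ o)) ∘ suc) , (proj₂ (proj₂ (proj₂ o)) ∘ suc)

    first-edge : Ē next x̄
    first-edge = subst (Ē next) (proj₁ (proj₂ o)) (proj₁ (proj₂ (proj₂ o)) 0)

    next∈last-layer : t x ≡ 3 → proj₁ next ∈ₛ Gi x (ℓ x)
    next∈last-layer t≡3 with first-edge
    ... | inj₁ (t≡2 , _) = ⊥-elim (2≢3 (trans (sym t≡2) t≡3))
    ... | inj₂ (_ , e)   = Equivalence.from T-≡ e

    next-head : t x ≡ 3 → mn (proj₁ next) 0 ≡ mn x L
    next-head t≡3 = trans (sym (lab≡mn0 (proj₁ next))) (proj₂ (Node.last-layer-reached x̄ _ (next∈last-layer t≡3)))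

    expand-<ℓ-1 : ∀ p → p < L → expand a p ≡ mn x p
    expand-<ℓ-1 p p<L = trans (Expansion.expand-< d a p (subst (p <_) (sym body-head) p<L))
                           (trans (cong (λ l → nth (proj₁ l) p d) head) (nth-γ x (ℕP.<-trans p<L (ℓ-1<ℓ x̄))))

    expand-t≡2 : t x ≡ 2 → ∀ p → L ≤ p → expand a p ≡ mn x L
    expand-t≡2 t≡2 p L≤p = trans (Expansion.expand-2 d a p (trans t-head t≡2) (subst (_≤ p) (sym body-head) L≤p))
                               (trans (cong₂ (λ l i → nth (proj₁ l) i d) head body-head) (nth-γ x (ℓ-1<ℓ x̄)))

    expand-t≡3 : t x ≡ 3 → ∀ p → L ≤ p → expand a p ≡ expand (a ∘ suc) (p ∸ L)
    expand-t≡3 t≡3 p L≤p =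
      trans (expand-leave a p (λ t≡2 → 2≢3 (trans (sym t≡2) (trans t-head t≡3)))
                          (subst (1 ≤_) (sym body-head) (1≤ℓ-1 x̄)) (subst (_≤ p) (sym body-head) L≤p))
            (cong (λ i → expand (a ∘ suc) (p ∸ i)) body-head)

    expand-t≡3-+ : t x ≡ 3 → ∀ q → expand a (L + q) ≡ expand (a ∘ suc) q
    expand-t≡3-+ t≡3 q = trans (expand-t≡3 t≡3 (L + q) (ℕP.m≤m+n L q)) (cong (expand (a ∘ suc)) (ℕP.m+n∸m≡n L q))

  expand-≤ℓ-1 : ∀ {x̄ a} (o : Bar.Occurrence x̄ a) p → p ≤ ℓ-1 x̄ → expand a p ≡ mn (proj₁ x̄) p
  expand-≤ℓ-1 {x̄} {a} o p p≤L with ℕP.m≤n⇒m<n∨m≡n p≤L | t≡2⊎t≡3 x̄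
  ... | inj₁ p<L  | _        = expand-<ℓ-1 p p<L
    where open OccurrenceFacts o
  ... | inj₂ refl | inj₁ t≡2 = expand-t≡2 t≡2 p ℕP.≤-refl
    where open OccurrenceFacts o
  ... | inj₂ refl | inj₂ t≡3 =
    trans (expand-t≡3 t≡3 p ℕP.≤-refl)
      (trans (cong (expand (a ∘ suc)) (ℕP.n∸n≡0 p))
        (trans (OccurrenceFacts.expand-<ℓ-1 tail-occurrence 0 (1≤ℓ-1 next)) (next-head t≡3)))
    where open OccurrenceFacts o

  expand-<ℓ : ∀ {x̄ a} (o : Bar.Occurrence x̄ a) p → p < ℓ (proj₁ x̄) → expand a p ≡ nth (γ (proj₁ x̄)) p d
  expand-<ℓ {x̄} o p p<ℓ = trans (expand-≤ℓ-1 o p (ℕP.∸-monoˡ-≤ 1 p<ℓ)) (sym (nth-γ (proj₁ x̄) p<ℓ))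

  continue-from-last-layer : ∀ x̄ {z β} → z ∈ₛ Gi (proj₁ x̄) (ℓ (proj₁ x̄)) → Occurrence z β →
                             Occurrence (proj₁ x̄) (splice (ℓ-1 x̄) (mn (proj₁ x̄)) β)
  continue-from-last-layer x̄ z∈ = Walk-++-Occurrence (proj₁ (Node.last-layer-reached x̄ _ z∈))

  approximation : ∀ K {x̄ a} (o : Bar.Occurrence x̄ a) →
                  ∃ λ β → Occurrence (proj₁ x̄) β × AgreeBelow K β (expand a)
  approximation K {x̄} {a} o with t≡2⊎t≡3 x̄
  ... | inj₁ t≡2 = splice L (mn x) (mn z) , continue-from-last-layer x̄ z∈ (mn-occurrence z) , agree
    where
      open OccurrenceFacts o
      z = proj₁ (Node.last-layer-continuation x̄)
      z∈ : z ∈ₛ Gi x (ℓ x)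
      z∈ = proj₁ (proj₂ (Node.last-layer-continuation x̄))
      agree : AgreeBelow K (splice L (mn x) (mn z)) (expand a)
      agree p _ with p ℕ.<? L
      ... | yes p<L = sym (expand-<ℓ-1 p p<L)
      ... | no p≮L  = trans (proj₂ (proj₂ (Node.last-layer-continuation x̄)) (p ∸ L))
                        (trans (Node.plateau x̄ t≡2 (p ∸ L)) (sym (expand-t≡2 t≡2 p (ℕP.≮⇒≥ p≮L))))
  approximation zero    {x̄} o | inj₂ _   = mn (proj₁ x̄) , mn-occurrence (proj₁ x̄) , λ _ ()
  approximation (suc K) {x̄} {a} o | inj₂ t≡3 with approximation K (OccurrenceFacts.tail-occurrence o)
  ... | (β , occ , agree) = splice L (mn x) β , continue-from-last-layer x̄ (next∈last-layer t≡3) occ , agree'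
    where
      open OccurrenceFacts o
      agree' : AgreeBelow (suc K) (splice L (mn x) β) (expand a)
      agree' p p<1+K with p ℕ.<? L
      ... | yes p<L = sym (expand-<ℓ-1 p p<L)
      ... | no p≮L  = trans (agree (p ∸ L) p∸L<K) (sym (expand-t≡3 t≡3 p L≤p))
        where
          L≤p : L ≤ p
          L≤p = ℕP.≮⇒≥ p≮L
          p∸L<K : p ∸ L < K
          p∸L<K = ℕP.<-≤-trans (ℕP.∸-monoˡ-< p<1+K L≤p) (ℕP.∸-monoʳ-≤ (suc K) (1≤ℓ-1 x̄))

  expand-not-below : ∀ {x̄ a} → Bar.Occurrence x̄ a → ¬ expand a ≺ω mn (proj₁ x̄)
  expand-not-below o lt@(P , _ , _) with approximation (suc P) o
  ... | (β , occ , agree) = mn-minimal _ occ (≺ω-respˡ-agreement lt (λ k k≤P → agree k (s≤s k≤P)))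

  ℓ-cong : ∀ {x y} → γ x ≡ γ y → ℓ x ≡ ℓ y
  ℓ-cong {x} {y} γx≡γy = trans (sym (length-γ x)) (trans (cong length γx≡γy) (length-γ y))

  same-γ-agree : ∀ {x̄ ȳ a b} → Bar.Occurrence x̄ a → Bar.Occurrence ȳ b →
                 γ (proj₁ x̄) ≡ γ (proj₁ ȳ) → AgreeBelow (ℓ (proj₁ x̄)) (expand a) (expand b)
  same-γ-agree o o' γx≡γy p p<ℓ =
    trans (expand-<ℓ o p p<ℓ)
      (trans (cong (λ γs → nth γs p d) γx≡γy) (sym (expand-<ℓ o' p (subst (p <_) (ℓ-cong γx≡γy) p<ℓ))))

  same-head : ∀ {x̄ ȳ a b} → Bar.Occurrence x̄ a → Bar.Occurrence ȳ b → a 0 ≡ b 0 → λ̄ x̄ ≡ λ̄ ȳ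
  same-head o o' a0≡b0 = trans (sym (OccurrenceFacts.head o)) (trans a0≡b0 (OccurrenceFacts.head o'))

  same-γ-continues : ∀ x̄ {ȳ b} → Bar.Occurrence ȳ b → γ (proj₁ x̄) ≡ γ (proj₁ ȳ) → t (proj₁ ȳ) ≡ 3 →
                     expand (b ∘ suc) ≈ω shift (ℓ-1 x̄) (expand b)
  same-γ-continues x̄ {b = b} o' γx≡γy ty≡3 q =
    sym (trans (cong (λ i → expand b (i ∸ 1 + q)) (ℓ-cong γx≡γy)) (OccurrenceFacts.expand-t≡3-+ o' ty≡3 q))

  expand-≺-precedes : ∀ {x̄ ȳ a b} → Bar.Occurrence x̄ a → Bar.Occurrence ȳ b →
    let x = proj₁ x̄ ; y = proj₁ ȳ in ¬ IsPrefix (γ x) (γ y) → γ x ≺fin γ y → expand a ≺ω expand b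
  expand-≺-precedes {x , _} {y , _} o o' γx⋠γy γx≺γy with ≺fin-position (γ x) (γ y) d γx⋠γy γx≺γy
  ... | (j , j<∣γx∣ , j<∣γy∣ , agree , differ) =
    j , (λ q q<j → trans (expand-<ℓ o q (ℕP.<-trans q<j j<ℓx))
                    (trans (agree q q<j) (sym (expand-<ℓ o' q (ℕP.<-trans q<j j<ℓy))))) ,
    subst₂ Fin._<_ (sym (expand-<ℓ o j j<ℓx)) (sym (expand-<ℓ o' j j<ℓy)) differ
    where
      j<ℓx : j < ℓ x
      j<ℓx = subst (j <_) (length-γ x) j<∣γx∣
      j<ℓy : j < ℓ y
      j<ℓy = subst (j <_) (length-γ y) j<∣γy∣

  -- From the last letter c of γ on, a continues with c forever while b enters a node
  -- z whose minimum rises above c and which it cannot undercut.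
  expand-≺-plateau : ∀ {x̄ ȳ a b} → Bar.Occurrence x̄ a → Bar.Occurrence ȳ b →
    γ (proj₁ x̄) ≡ γ (proj₁ ȳ) → t (proj₁ x̄) ≡ 2 → t (proj₁ ȳ) ≡ 3 → expand a ≺ω expand b
  expand-≺-plateau {x̄@(x , _)} {ȳ@(y , _)} {a} {b} o o' γx≡γy tx≡2 ty≡3 =
    ≺ω-unshift L (λ p p<L → same-γ-agree o o' γx≡γy p (ℕP.<-trans p<L (ℓ-1<ℓ x̄)))
      (≺ω-resp-≈ω plateau-a (same-γ-continues x̄ o' γx≡γy ty≡3)
        (≺ω-⊀ω-trans (≺ω-resp-≈ω (λ _ → head-z) ≈ω-refl (Tau3-node z̄)) (expand-not-below tail-occurrence)))
    where
      open OccurrenceFacts o' using (tail-occurrence; next-head) renaming (next to z̄)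
      L : ℕ
      L = ℓ-1 x̄
      ℓx≡ℓy : ℓ x ≡ ℓ y
      ℓx≡ℓy = ℓ-cong γx≡γy
      head-z : mn (proj₁ z̄) 0 ≡ mn x L
      head-z = begin
        mn (proj₁ z̄) 0    ≡⟨ next-head ty≡3 ⟩
        mn y (ℓ-1 ȳ)      ≡⟨ cong (λ i → mn y (i ∸ 1)) (sym ℓx≡ℓy) ⟩
        mn y L            ≡⟨ sym (nth-γ y (subst (L <_) ℓx≡ℓy (ℓ-1<ℓ x̄))) ⟩
        nth (γ y) L d     ≡⟨ cong (λ γs → nth γs L d) (sym γx≡γy) ⟩
        nth (γ x) L d     ≡⟨ nth-γ x (ℓ-1<ℓ x̄) ⟩
        mn x L            ∎
        where open ≡-Reasoning
      plateau-a : constant (mn x L) ≈ω shift L (expand a)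
      plateau-a q = sym (OccurrenceFacts.expand-t≡2 o tx≡2 (L + q) (ℕP.m≤m+n L q))

  expand-after-body-not-below : ∀ {ȳ b} → Bar.Occurrence ȳ b →
    ¬ shift (ℓ-1 ȳ) (expand b) ≺ω constant (mn (proj₁ ȳ) (ℓ-1 ȳ))
  expand-after-body-not-below {ȳ} o lt with t≡2⊎t≡3 ȳ
  ... | inj₁ t≡2 =
    ≺ω-irrefl (≺ω-resp-≈ω (λ q → expand-t≡2 t≡2 (ℓ-1 ȳ + q) (ℕP.m≤m+n (ℓ-1 ȳ) q)) ≈ω-refl lt)
    where open OccurrenceFacts o
  ... | inj₂ t≡3 = expand-not-below tail-occurrence
        (≺ω-trans (≺ω-resp-≈ω (expand-t≡3-+ t≡3) ≈ω-refl lt)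
                  (≺ω-resp-≈ω (λ _ → next-head t≡3) ≈ω-refl (Tau3-node next)))
    where open OccurrenceFacts o

  -- Past γ_y the minimum of x descends (τ = 1 there) below its letter at that position,
  -- within the body of λ̄ x̄, while b does not.
  expand-≺-extends : ∀ {x̄ ȳ a b} → Bar.Occurrence x̄ a → Bar.Occurrence ȳ b →
    IsStrictPrefix (γ (proj₁ ȳ)) (γ (proj₁ x̄)) → expand a ≺ω expand b
  expand-≺-extends {x̄@(x , _)} {ȳ@(y , _)} {a} {b} o o' γy⊏γx =
    ≺ω-unshift Ly agree-Ly
      (≺ω-⊀ω-trans (≺ω-respˡ-agreement (Tau1⇒≺ω-constant S τS) agree-S)
                   (λ lt → expand-after-body-not-below o' (≺ω-resp-≈ω ≈ω-refl (λ _ → S0) lt)))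
    where
      ℓy<ℓx : ℓ y < ℓ x
      ℓy<ℓx = subst₂ _<_ (length-γ y) (length-γ x) (strict-prefix-shorter γy⊏γx)
      Ly = ℓ-1 ȳ
      Ly≤Lx : Ly ≤ ℓ-1 x̄
      Ly≤Lx = ℕP.∸-monoˡ-≤ 1 (ℕP.<⇒≤ ℓy<ℓx)
      mn-x≡mn-y : ∀ q → q < ℓ y → mn x q ≡ mn y q
      mn-x≡mn-y q q<ℓy = trans (sym (nth-γ x (ℕP.<-trans q<ℓy ℓy<ℓx)))
        (trans (sym (strict-prefix-nth d γy⊏γx q (subst (q <_) (sym (length-γ y)) q<ℓy))) (nth-γ y q<ℓy))
      S = shift Ly (mn x)
      τS : Tau S 1
      τS = Node.Tau1-before-ℓ x̄ (ℓ y) (Node.2≤ℓ ȳ) ℓy<ℓx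
      S0 : S 0 ≡ mn y Ly
      S0 = trans (cong (mn x) (ℕP.+-identityʳ Ly)) (mn-x≡mn-y Ly (ℓ-1<ℓ ȳ))
      agree-Ly : AgreeBelow Ly (expand a) (expand b)
      agree-Ly p p<Ly = trans (expand-≤ℓ-1 o p (ℕP.≤-trans (ℕP.<⇒≤ p<Ly) Ly≤Lx))
                          (trans (mn-x≡mn-y p (ℕP.<-trans p<Ly (ℓ-1<ℓ ȳ))) (sym (expand-≤ℓ-1 o' p (ℕP.<⇒≤ p<Ly))))
      agree-S : ∀ q → q ≤ suc (proj₁ τS) → shift Ly (expand a) q ≡ S q
      agree-S q q≤1+j = expand-≤ℓ-1 o (Ly + q)
        (ℕP.≤-trans (ℕP.+-monoʳ-≤ Ly q≤1+j) (Node.Tau1-witness-before-last x̄ Ly τS Ly≤Lx))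

  ≺'-irrefl : ∀ l → ¬ l ≺' l
  ≺'-irrefl (γs , _) (inj₁ (γs⋠γs , _))          = γs⋠γs ([] , ++-identityʳ γs)
  ≺'-irrefl (γs , _) (inj₂ (inj₁ (_ , x≡2 , x≡3))) = 2≢3 (trans (sym x≡2) x≡3)
  ≺'-irrefl (γs , _) (inj₂ (inj₂ γs⊏γs))          = strict-prefix-irrefl γs⊏γs

  expand-≺-head : ∀ {x̄ ȳ a b} → Bar.Occurrence x̄ a → Bar.Occurrence ȳ b → a 0 ≺' b 0 → expand a ≺ω expand b
  expand-≺-head o o' lt with subst₂ _≺'_ (OccurrenceFacts.head o) (OccurrenceFacts.head o') lt
  ... | inj₁ (γx⋠γy , γx≺γy)           = expand-≺-precedes o o' γx⋠γy γx≺γy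
  ... | inj₂ (inj₁ (γx≡γy , tx≡2 , ty≡3)) = expand-≺-plateau o o' γx≡γy tx≡2 ty≡3
  ... | inj₂ (inj₂ γy⊏γx)               = expand-≺-extends o o' γy⊏γx

  stationary : ∀ {x̄ a} (o : Bar.Occurrence x̄ a) → t (proj₁ x̄) ≡ 2 → ∀ i → proj₁ (proj₁ o i) ≡ proj₁ x̄
  stationary o t≡2 zero    = cong proj₁ (proj₁ (proj₂ o))
  stationary o t≡2 (suc i) with proj₁ (proj₂ (proj₂ o)) i
  ... | inj₁ (_ , e)   = trans e (stationary o t≡2 i)
  ... | inj₂ (t≡3 , _) = ⊥-elim (2≢3 (trans (sym t≡2) (trans (cong t (sym (stationary o t≡2 i))) t≡3)))

  stationary-labels : ∀ {x̄ a} (o : Bar.Occurrence x̄ a) → t (proj₁ x̄) ≡ 2 → ∀ i → a i ≡ a 0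
  stationary-labels o t≡2 i = trans (sym (proj₂ (proj₂ (proj₂ o)) i))
    (trans (cong (λ w → γ w , t w) (stationary o t≡2 i)) (sym (OccurrenceFacts.head o)))

  expand-mono : ∀ i {x̄ ȳ a b} → Bar.Occurrence x̄ a → Bar.Occurrence ȳ b →
                (∀ j → j < i → a j ≡ b j) → a i ≺' b i → expand a ≺ω expand b
  expand-mono zero    o o' _     lt = expand-≺-head o o' lt
  expand-mono (suc i) {x̄} {ȳ} {a} {b} o o' agree lt with t≡2⊎t≡3 x̄
  ... | inj₁ tx≡2 = ⊥-elim (≺'-irrefl (b (suc i)) (subst (_≺' b (suc i)) a≡b lt))
    where
      ty≡2 : t (proj₁ ȳ) ≡ 2
      ty≡2 = trans (cong proj₂ (sym (same-head o o' (agree 0 (s≤s z≤n))))) tx≡2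
      a≡b : a (suc i) ≡ b (suc i)
      a≡b = trans (stationary-labels o tx≡2 (suc i))
              (trans (agree 0 (s≤s z≤n)) (sym (stationary-labels o' ty≡2 (suc i))))
  ... | inj₂ tx≡3 =
    ≺ω-unshift (ℓ-1 x̄) (λ p p<L → same-γ-agree o o' γx≡γy p (ℕP.<-trans p<L (ℓ-1<ℓ x̄)))
      (≺ω-resp-≈ω (λ q → sym (OccurrenceFacts.expand-t≡3-+ o tx≡3 q)) (same-γ-continues x̄ o' γx≡γy ty≡3)
        (expand-mono i (OccurrenceFacts.tail-occurrence o) (OccurrenceFacts.tail-occurrence o')
                       (λ j j<i → agree (suc j) (s≤s j<i)) lt))
    where
      λ̄x≡λ̄y : λ̄ x̄ ≡ λ̄ ȳ
      λ̄x≡λ̄y = same-head o o' (agree 0 (s≤s z≤n))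
      γx≡γy : γ (proj₁ x̄) ≡ γ (proj₁ ȳ)
      γx≡γy = cong proj₁ λ̄x≡λ̄y
      ty≡3 : t (proj₁ ȳ) ≡ 3
      ty≡3 = trans (cong proj₂ (sym λ̄x≡λ̄y)) tx≡3

  expand-≺ω : ∀ {x̄ ȳ a b} → Bar.Occurrence x̄ a → Bar.Occurrence ȳ b → a Bar.≺ω b → expand a ≺ω expand b
  expand-≺ω o o' (i , agree , lt) = expand-mono i o o' agree lt

  t≢2⇒t≡3 : ∀ w̄ → ¬ t (proj₁ w̄) ≡ 2 → t (proj₁ w̄) ≡ 3
  t≢2⇒t≡3 w̄ t≢2 with t≡2⊎t≡3 w̄
  ... | inj₁ t≡2 = ⊥-elim (t≢2 t≡2)
  ... | inj₂ t≡3 = t≡3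

  continuation-τ : ∀ w̄ → t (proj₁ w̄) ≡ 3 → τ (proj₁ (Node.last-layer-continuation w̄)) ≡ 3
  continuation-τ w̄@(w , _) t≡3 = Tau-unique _ 3 (τ-spec z)
    (Tau-resp-≈ω 3 (≈ω-sym (proj₂ (proj₂ (Node.last-layer-continuation w̄))))
                   (subst (Tau (shift (ℓ-1 w̄) (mn w))) t≡3 (Node.Tau-last w̄)))
    where z = proj₁ (Node.last-layer-continuation w̄)

  successor : V̄ → V̄
  successor w̄ with t (proj₁ w̄) ℕ.≟ 2
  ... | yes _  = w̄
  ... | no t≢2 = proj₁ (Node.last-layer-continuation w̄) , continuation-τ w̄ (t≢2⇒t≡3 w̄ t≢2)

  successor-edge : ∀ w̄ → Ē (successor w̄) w̄
  successor-edge w̄ with t (proj₁ w̄) ℕ.≟ 2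
  ... | yes t≡2 = inj₁ (t≡2 , refl)
  ... | no t≢2  = inj₂ (t≢2⇒t≡3 w̄ t≢2 , Equivalence.to T-≡ (proj₁ (proj₂ (Node.last-layer-continuation w̄))))

  successor-mn : ∀ w̄ → ¬ t (proj₁ w̄) ≡ 2 → mn (proj₁ (successor w̄)) ≈ω shift (ℓ-1 w̄) (mn (proj₁ w̄))
  successor-mn w̄ t≢2 with t (proj₁ w̄) ℕ.≟ 2
  ... | yes t≡2 = ⊥-elim (t≢2 t≡2)
  ... | no _    = proj₂ (proj₂ (Node.last-layer-continuation w̄))

  canonical : V̄ → ℕ → V̄
  canonical w̄ zero    = w̄
  canonical w̄ (suc i) = canonical (successor w̄) i

  canonical-occurrence : ∀ w̄ → Bar.Occurrence w̄ (λ̄ ∘ canonical w̄)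
  canonical-occurrence w̄ = canonical w̄ , refl , edges w̄ , (λ _ → refl)
    where
      edges : ∀ w̄ i → Ē (canonical w̄ (suc i)) (canonical w̄ i)
      edges w̄ zero    = successor-edge w̄
      edges w̄ (suc i) = edges (successor w̄) i

  expand-canonical : ∀ N w̄ p → p < N → expand (λ̄ ∘ canonical w̄) p ≡ mn (proj₁ w̄) p
  expand-canonical (suc N) w̄@(w , _) p p<1+N with p ℕ.≤? ℓ-1 w̄ | t (proj₁ w̄) ℕ.≟ 2
  ... | yes p≤L | _        = expand-≤ℓ-1 (canonical-occurrence w̄) p p≤L
  ... | no p≰L  | yes t≡2 = begin
    expand (λ̄ ∘ canonical w̄) p ≡⟨ OccurrenceFacts.expand-t≡2 (canonical-occurrence w̄) t≡2 p L≤p ⟩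
    mn w (ℓ-1 w̄)                ≡⟨ sym (Node.plateau w̄ t≡2 (p ∸ ℓ-1 w̄)) ⟩
    mn w (ℓ-1 w̄ + (p ∸ ℓ-1 w̄)) ≡⟨ cong (mn w) (ℕP.m+[n∸m]≡n L≤p) ⟩
    mn w p                      ∎
    where
      open ≡-Reasoning
      L≤p = ℕP.<⇒≤ (ℕP.≰⇒> p≰L)
  ... | no p≰L  | no t≢2  = begin
    expand (λ̄ ∘ canonical w̄) p
      ≡⟨ OccurrenceFacts.expand-t≡3 (canonical-occurrence w̄) (t≢2⇒t≡3 w̄ t≢2) p L≤p ⟩
    expand (λ̄ ∘ canonical (successor w̄)) (p ∸ ℓ-1 w̄)
      ≡⟨ expand-canonical N (successor w̄) (p ∸ ℓ-1 w̄) p∸L<N ⟩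
    mn (proj₁ (successor w̄)) (p ∸ ℓ-1 w̄)              ≡⟨ successor-mn w̄ t≢2 (p ∸ ℓ-1 w̄) ⟩
    mn w (ℓ-1 w̄ + (p ∸ ℓ-1 w̄))                        ≡⟨ cong (mn w) (ℕP.m+[n∸m]≡n L≤p) ⟩
    mn w p                                             ∎
    where
      open ≡-Reasoning
      L≤p = ℕP.<⇒≤ (ℕP.≰⇒> p≰L)
      p∸L<N : p ∸ ℓ-1 w̄ < N
      p∸L<N = ℕP.<-≤-trans (ℕP.∸-monoˡ-< p<1+N L≤p) (ℕP.∸-monoʳ-≤ (suc N) (1≤ℓ-1 w̄))

  -- Not below min_u by approximation, and not above it because the canonical
  -- occurrence expands to min_u.
  expand-min : ∀ {ū ᾱ} → Bar.IsMin ū ᾱ → expand ᾱ ≈ω mn (proj₁ ū)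
  expand-min {ū} {ᾱ} (occ , minimal) = ≈ω-from-incomparable (expand-not-below occ) above
    where
      canonical≈mn : expand (λ̄ ∘ canonical ū) ≈ω mn (proj₁ ū)
      canonical≈mn p = expand-canonical (suc p) ū p (ℕP.n<1+n p)
      above : ¬ mn (proj₁ ū) ≺ω expand ᾱ
      above lt with minimal _ (canonical-occurrence ū)
      ... | inj₁ ᾱ≺ = ≺ω-asym (expand-≺ω occ (canonical-occurrence ū) ᾱ≺)
                              (≺ω-resp-≈ω (≈ω-sym canonical≈mn) ≈ω-refl lt)
      ... | inj₂ ᾱ≈ = ≺ω-irrefl (≺ω-resp-≈ω ≈ω-refl
                        (λ p → trans (expand-agree ᾱ _ p (λ k _ → ᾱ≈ k)) (canonical≈mn p)) lt)

  λ̄-trichotomy : ∀ x̄ ȳ → λ̄ x̄ ≺' λ̄ ȳ ⊎ λ̄ x̄ ≡ λ̄ ȳ ⊎ λ̄ ȳ ≺' λ̄ x̄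
  λ̄-trichotomy x̄@(x , _) ȳ@(y , _) with compareFinStr (γ x) (γ y)
  ... | strict-prefix γx⊏γy  = inj₂ (inj₂ (inj₂ (inj₂ γx⊏γy)))
  ... | strict-prefix⁻ γy⊏γx = inj₁ (inj₂ (inj₂ γy⊏γx))
  ... | precedes γx⋠γy γx≺γy  = inj₁ (inj₁ (γx⋠γy , γx≺γy))
  ... | precedes⁻ γy⋠γx γy≺γx = inj₂ (inj₂ (inj₁ (γy⋠γx , γy≺γx)))
  ... | equal γx≡γy with t≡2⊎t≡3 x̄ | t≡2⊎t≡3 ȳ
  ...   | inj₁ tx≡2 | inj₁ ty≡2 = inj₂ (inj₁ (cong₂ _,_ γx≡γy (trans tx≡2 (sym ty≡2))))
  ...   | inj₂ tx≡3 | inj₂ ty≡3 = inj₂ (inj₁ (cong₂ _,_ γx≡γy (trans tx≡3 (sym ty≡3))))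
  ...   | inj₁ tx≡2 | inj₂ ty≡3 = inj₁ (inj₂ (inj₁ (γx≡γy , tx≡2 , ty≡3)))
  ...   | inj₂ tx≡3 | inj₁ ty≡2 = inj₂ (inj₂ (inj₂ (inj₁ (sym γx≡γy , ty≡2 , tx≡3))))

  compare-occurrences : ∀ {x̄ ȳ a b} → Bar.Occurrence x̄ a → Bar.Occurrence ȳ b →
                        ∀ K → (∀ k → k < K → a k ≡ b k) ⊎ a Bar.≺ω b ⊎ b Bar.≺ω a
  compare-occurrences (ws , _ , _ , labels) (ws' , _ , _ , labels') =
    LexProperties.firstDifference _≺'_ λ i →
      subst₂ (λ p q → p ≺' q ⊎ p ≡ q ⊎ q ≺' p) (labels i) (labels' i) (λ̄-trichotomy (ws i) (ws' i))

  expand-order-embedding : ∀ {x̄ ȳ a b} → Bar.Occurrence x̄ a → Bar.Occurrence ȳ b →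
    ((expand a ≈ω expand b) ⇔ (a Bar.≈ω b)) × ((expand a ≺ω expand b) ⇔ (a Bar.≺ω b))
  expand-order-embedding {a = a} {b} o o' =
    mk⇔ reflects-≈ω (λ a≈b p → expand-agree a b p (λ k _ → a≈b k)) ,
    mk⇔ reflects-≺ω (expand-≺ω o o')
    where
      reflects-≈ω : expand a ≈ω expand b → a Bar.≈ω b
      reflects-≈ω e k with compare-occurrences o o' (suc k)
      ... | inj₁ agree      = agree k (ℕP.n<1+n k)
      ... | inj₂ (inj₁ a≺b) = ⊥-elim (≺ω⇒≉ω (expand-≺ω o o' a≺b) e)
      ... | inj₂ (inj₂ b≺a) = ⊥-elim (≺ω⇒≉ω (expand-≺ω o' o b≺a) (≈ω-sym e))
      reflects-≺ω : expand a ≺ω expand b → a Bar.≺ω b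
      reflects-≺ω lt@(i , _ , differ) with compare-occurrences o o' (suc i)
      ... | inj₁ agree      = ⊥-elim (FinP.<-irrefl (expand-agree a b i (λ k k≤i → agree k (s≤s k≤i))) differ)
      ... | inj₂ (inj₁ a≺b) = a≺b
      ... | inj₂ (inj₂ b≺a) = ⊥-elim (≺ω-asym (expand-≺ω o' o b≺a) lt)

corollary22 : (G : Graph) (D : MinData G) (u v : Fin (Graph.n G))
    (hu : MinData.τ D u ≡ 3) (hv : MinData.τ D v ≡ 3)
    (ᾱ β̄ : Derived.Bar.Str G D) →
    Derived.Bar.IsMin G D (u , hu) ᾱ →
    Derived.Bar.IsMin G D (v , hv) β̄ →
    let open Derived G D in
    ((mn u ≈ω mn v) ⇔ (ᾱ Bar.≈ω β̄)) × ((mn u ≺ω mn v) ⇔ (ᾱ Bar.≺ω β̄))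
corollary22 G D u v hu hv ᾱ β̄ minᾱ minβ̄ =
  ⇔-trans (≈ω-cong-⇔ ᾱ-expands β̄-expands) (proj₁ embedding) ,
  ⇔-trans (≺ω-cong-⇔ ᾱ-expands β̄-expands) (proj₂ embedding)
  where
    open Graph G using (m)
    open Correspondence G D (Graph.lab G u)
    open LexProperties (Fin._<_ {m})
    ᾱ-expands = ≈ω-sym (expand-min minᾱ)
    β̄-expands = ≈ω-sym (expand-min minβ̄)
    embedding = expand-order-embedding (proj₁ minᾱ) (proj₁ minβ̄)
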